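{- Let $M$ be a maximal planar graph or an $n$-semi-MPG with $n\ge 4$. The following are equivalent: (a) $M$ is 4-colorable; (b) $M$ has an RGB-tiling; (c) $M$ has an R-tiling without red odd-cycles.
   Context: A maximal planar graph (MPG) is a simple plane graph all of whose faces, including the outer one, are triangles. An $n$-semi-MPG is a connected simple plane graph in which every face is a triangle except one designated face, the outer facet, which is an $n$-gon. An R-tiling of $M$ is a map $T_r:E(M)\to\{\text{red},\text{black}\}$ such that every triangular face (other than the outer facet) has exactly one red edge. An RGB-tiling is a map $E(M)\to\{\text{red},\text{green},\text{blue}\}$ such that every triangular face (other than the outer facet) has its three edges of three different colors. A red odd-cycle is a cycle of odd length all of whose edges are red. 4-colorable means having a proper vertex-coloring with 4 colors. -}

module Defs where

open import Data.Nat using (ℕ; zero; suc; _+_; _*_; _≤_; _<_; _%_)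
open import Data.Fin using (Fin; toℕ)
open import Data.Bool using (Bool; true; false)
open import Data.Product using (Σ; ∃; _×_; _,_)
open import Data.Unit using (⊤)
open import Data.Empty using (⊥)
open import Relation.Binary.PropositionalEquality using (_≡_; _≢_)
open import Function.Bundles using (_⇔_)
open import Function.Definitions using (Injective; Surjective)

iter : {A : Set} → (A → A) → ℕ → A → A
iter f zero    x = x
iter f (suc n) x = f (iter f n x)

-- ℓ labels exactly the orbits of the permutation π, by the labels Fin k
-- (so k is the number of orbits).
OrbitLabel : {D : Set} {k : ℕ} → (D → D) → (D → Fin k) → Set
OrbitLabel {D} {k} π ℓ =
  (∀ x y → (ℓ x ≡ ℓ y) ⇔ (∃ λ i → iter π i x ≡ y))
  × (∀ (c : Fin k) → ∃ λ x → ℓ x ≡ c)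

data Reach {D : Set} (α σ : D → D) (x : D) : D → Set where
  here : Reach α σ x x
  viaα : ∀ {y} → Reach α σ x y → Reach α σ x (α y)
  viaσ : ∀ {y} → Reach α σ x y → Reach α σ x (σ y)

-- A connected simple plane graph, encoded as a combinatorial map
-- (rotation system) of genus 0.  Darts are Fin nd; α is the
-- edge involution, σ the rotation around vertices, φ = σ ∘ α walks around faces.
record PlaneGraph : Set where
  field
    nd : ℕ
    α σ : Fin nd → Fin nd
    α-invol : ∀ x → α (α x) ≡ x
    α-fpf   : ∀ x → α x ≢ x
    σ-inj   : Injective _≡_ _≡_ σ
    nv ne nf : ℕ
    vtx  : Fin nd → Fin nv      -- tail vertex of a dart
    edge : Fin nd → Fin ne
    face : Fin nd → Fin nf
    vtx-orb  : OrbitLabel σ vtx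
    edge-orb : OrbitLabel α edge
    face-orb : OrbitLabel (λ x → σ (α x)) face
    connected : ∀ x y → Reach α σ x y
    euler : nv + nf ≡ ne + 2     -- genus 0, i.e. the map is planar
    no-loop  : ∀ x → vtx x ≢ vtx (α x)
    no-multi : ∀ x y → vtx x ≡ vtx y → vtx (α x) ≡ vtx (α y) → x ≡ y

  Dart : Set
  Dart = Fin nd

  φ : Dart → Dart
  φ x = σ (α x)

  IsTri : Dart → Set
  IsTri x = (iter φ 3 x ≡ x) × (φ x ≢ x)

open PlaneGraph public

-- Which kind of graph: a maximal planar graph, or an n-semi-MPG whose
-- outer facet is the face containing the dart o.
data Kind (M : PlaneGraph) : Set where
  mpg  : Kind M
  semi : (n : ℕ) (o : Dart M) → Kind M

Inner : (M : PlaneGraph) → Kind M → Dart M → Set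
Inner M mpg        x = ⊤
Inner M (semi n o) x = face M x ≢ face M o

IsNGon : (M : PlaneGraph) → ℕ → Dart M → Set
IsNGon M n o =
  (iter (φ M) n o ≡ o)
  × (∀ (i j : Fin n) → vtx M (iter (φ M) (toℕ i) o) ≡ vtx M (iter (φ M) (toℕ j) o) → i ≡ j)

Valid : (M : PlaneGraph) → Kind M → Set
Valid M mpg        = ∀ x → IsTri M x
Valid M (semi n o) = (4 ≤ n) × IsNGon M n o × (∀ x → Inner M (semi n o) x → IsTri M x)

FourColorable : PlaneGraph → Set
FourColorable M = Σ (Fin (nv M) → Fin 4) λ c → ∀ x → c (vtx M x) ≢ c (vtx M (α M x))

redCount : Bool → ℕ
redCount true  = 1
redCount false = 0

-- R-tiling: true = red, false = black
IsRTiling : (M : PlaneGraph) → Kind M → (Fin (ne M) → Bool) → Set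
IsRTiling M k T = ∀ x → Inner M k x →
  redCount (T (edge M x)) + redCount (T (edge M (φ M x))) + redCount (T (edge M (φ M (φ M x)))) ≡ 1

IsRGBTiling : (M : PlaneGraph) → Kind M → (Fin (ne M) → Fin 3) → Set
IsRGBTiling M k c = ∀ x → Inner M k x →
  (c (edge M x) ≢ c (edge M (φ M x)))
  × (c (edge M (φ M x)) ≢ c (edge M (φ M (φ M x))))
  × (c (edge M x) ≢ c (edge M (φ M (φ M x))))

HasRGBTiling : (M : PlaneGraph) → Kind M → Set
HasRGBTiling M k = Σ (Fin (ne M) → Fin 3) (IsRGBTiling M k)

RedOddCycle : (M : PlaneGraph) → (Fin (ne M) → Bool) → Set
RedOddCycle M T = Σ ℕ λ len → Σ (ℕ → Dart M) λ w →
  (3 ≤ len) × (len % 2 ≡ 1)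
  × (∀ i → suc i < len → vtx M (α M (w i)) ≡ vtx M (w (suc i)))
  × (∀ i → suc i ≡ len → vtx M (α M (w i)) ≡ vtx M (w 0))
  × (∀ i j → i < len → j < len → vtx M (w i) ≡ vtx M (w j) → i ≡ j)
  × (∀ i → i < len → T (edge M (w i)) ≡ true)

HasRTilingNoRedOddCycle : (M : PlaneGraph) → Kind M → Set
HasRTilingNoRedOddCycle M k =
  Σ (Fin (ne M) → Bool) λ T → IsRTiling M k T × (RedOddCycle M T → ⊥)

{-# OPTIONS --safe #-}
-- Identify the four vertex colours with GF(2)² and the three edge colours with its non-zero
-- elements.  Colouring each edge by the difference of its endpoint colours turns a 4-colouring
-- into an RGB-tiling.  Conversely, each coordinate of an RGB-tiling sums to zero around every
-- inner triangle, hence (by parity) around the outer facet too; on a plane map every such edge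
-- labelling is the coboundary of a vertex labelling, because Euler's formula and rank–nullity
-- over GF(2) give the image of δ and the kernel of ∂ the same size.  The two potentials are a
-- 4-colouring.  The red edges of an RGB-tiling are those on which the first potential flips, so
-- red cycles are even; conversely, if there is no red odd cycle the red graph is bipartite, and
-- its 2-colouring together with a potential of the black edges is a 4-colouring.

module Submission where

open import Defs
open import Algebra.Bundles using (CommutativeMonoid; CommutativeRing; Semiring)
open import Data.Bool using (Bool; true; false; not; _xor_; _∧_; if_then_else_)
import Data.Bool.Properties as Boolₚ
import Data.Nat.Properties as ℕₚ
open import Algebra.Properties.CommutativeSemigroup ℕₚ.+-commutativeSemigroup
  using () renaming (interchange to +-interchange)
open import Algebra.Properties.CommutativeSemigroup
  (CommutativeMonoid.commutativeSemigroup (Semiring.+-commutativeMonoid (CommutativeRing.semiring Boolₚ.xor-∧-commutativeRing)))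
  using () renaming (interchange to xor-interchange)
open import Algebra.Properties.CommutativeSemigroup (CommutativeMonoid.commutativeSemigroup Boolₚ.∧-commutativeMonoid)
  using () renaming (x∙yz≈y∙xz to ∧-left-swap)
open import Algebra.Properties.Semiring.Sum (CommutativeRing.semiring Boolₚ.xor-∧-commutativeRing)
  using (sum; sum-syntax; ∑-comm; ∑-distrib-+; *-distribˡ-sum; *-distribʳ-sum; sum-cong-≗; sum-replicate-zero)
open import Data.Empty using (⊥; ⊥-elim)
open import Data.Fin using (Fin; zero; suc; toℕ)
import Data.Fin as Fin
open import Data.Fin.Properties using (_≟_; all?)
import Data.Fin.Properties as Finₚ
open import Data.Fin.Subset.Properties using (anySubset?)
open import Data.Nat using (ℕ; zero; suc; _+_; _*_; _^_; _∸_; _≤_; _<_; z≤n; s≤s; s≤s⁻¹; _%_)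
open import Data.Nat.DivMod using ([m+n]%n≡m%n)
open import Data.Nat.Induction using (<-rec)
open import Data.Nat.Solver using (module +-*-Solver)
open import Data.Product using (∃; ∃₂; _×_; _,_; proj₁; proj₂)
open import Data.Product.Properties using (,-injective)
open import Data.Sum using (_⊎_; inj₁; inj₂)
open import Data.Unit using (⊤; tt)
open import Data.Vec using (Vec; []; _∷_; replicate; zipWith; tabulate; lookup)
import Data.Vec.Properties as Vecₚ
open import Function using (_∘_; case_of_)
open import Function.Bundles using (_⇔_; mk⇔; Equivalence)
open import Level using (0ℓ)
open import Relation.Binary.Definitions using (tri<; tri≈; tri>)
open import Relation.Binary.PropositionalEquality
open import Relation.Nullary using (Dec; yes; no; does; ¬_)
open import Relation.Nullary.Decidable using (dec-true; dec-false; does-⇔; toSum; map′; from-yes; ¬?; _×-dec_; _→-dec_)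
open import Relation.Unary using (Pred; Decidable)
open import Relation.Unary.Properties using (_∪?_; ∁?)

-- Linear algebra over GF(2)

private
  variable
    n m : ℕ

infixl 6 _⊕_

_⊕_ : Vec Bool n → Vec Bool n → Vec Bool n
_⊕_ = zipWith _xor_

zeros : ∀ n → Vec Bool n
zeros n = replicate n false

_≟ⱽ_ : (u v : Vec Bool n) → Dec (u ≡ v)
_≟ⱽ_ = Vecₚ.≡-dec Boolₚ._≟_

lookup-ext : {u v : Vec Bool n} → (∀ i → lookup u i ≡ lookup v i) → u ≡ v
lookup-ext {u = u} {v} eq = trans (sym (Vecₚ.tabulate∘lookup u)) (trans (Vecₚ.tabulate-cong eq) (Vecₚ.tabulate∘lookup v))

lookup-⊕ : (u v : Vec Bool n) (i : Fin n) → lookup (u ⊕ v) i ≡ lookup u i xor lookup v i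
lookup-⊕ u v i = Vecₚ.lookup-zipWith _xor_ i u v

⊕-assoc : (u v w : Vec Bool n) → (u ⊕ v) ⊕ w ≡ u ⊕ (v ⊕ w)
⊕-assoc = Vecₚ.zipWith-assoc Boolₚ.xor-assoc

⊕-comm : (u v : Vec Bool n) → u ⊕ v ≡ v ⊕ u
⊕-comm = Vecₚ.zipWith-comm Boolₚ.xor-comm

⊕-identityˡ : (u : Vec Bool n) → zeros n ⊕ u ≡ u
⊕-identityˡ = Vecₚ.zipWith-identityˡ Boolₚ.xor-identityˡ

⊕-self : (u : Vec Bool n) → u ⊕ u ≡ zeros n
⊕-self []      = refl
⊕-self (a ∷ u) = cong₂ _∷_ (Boolₚ.xor-same a) (⊕-self u)

⊕-cancelˡ : (u v : Vec Bool n) → u ⊕ (u ⊕ v) ≡ v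
⊕-cancelˡ u v = begin
  u ⊕ (u ⊕ v)   ≡⟨ ⊕-assoc u u v ⟨
  (u ⊕ u) ⊕ v   ≡⟨ cong (_⊕ v) (⊕-self u) ⟩
  zeros _ ⊕ v   ≡⟨ ⊕-identityˡ v ⟩
  v             ∎
  where open ≡-Reasoning

⊕-cancelʳ : (u v : Vec Bool n) → (v ⊕ u) ⊕ u ≡ v
⊕-cancelʳ u v = trans (cong (_⊕ u) (⊕-comm v u)) (trans (⊕-comm (u ⊕ v) u) (⊕-cancelˡ u v))

⊕-telescope : (u v w : Vec Bool n) → (u ⊕ v) ⊕ (v ⊕ w) ≡ u ⊕ w
⊕-telescope u v w = trans (⊕-assoc u v (v ⊕ w)) (cong (u ⊕_) (⊕-cancelˡ v w))

⊕-moveˡ : (c u w : Vec Bool n) → c ⊕ u ≡ w → u ≡ w ⊕ c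
⊕-moveˡ c u w c⊕u≡w = trans (sym (⊕-cancelˡ c u)) (trans (cong (c ⊕_) c⊕u≡w) (⊕-comm c w))

⊕-moveʳ : (c u w : Vec Bool n) → u ≡ w ⊕ c → c ⊕ u ≡ w
⊕-moveʳ c u w u≡w⊕c = trans (cong (c ⊕_) (trans u≡w⊕c (⊕-comm w c))) (⊕-cancelˡ c w)

count : {P : Pred (Vec Bool n) 0ℓ} → Decidable P → ℕ
count {zero}  P? = if does (P? []) then 1 else 0
count {suc n} P? = count (P? ∘ (false ∷_)) + count (P? ∘ (true ∷_))

count-cong : {P Q : Pred (Vec Bool n) 0ℓ} → (P? : Decidable P) (Q? : Decidable Q) → (∀ v → P v → Q v) → (∀ v → Q v → P v) →
             count P? ≡ count Q?
count-cong {zero}  P? Q? P⇒Q Q⇒P =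
  cong (if_then 1 else 0) (does-⇔ (mk⇔ (P⇒Q []) (Q⇒P [])) (P? []) (Q? []))
count-cong {suc n} P? Q? P⇒Q Q⇒P =
  cong₂ _+_ (count-cong _ _ (P⇒Q ∘ (false ∷_)) (Q⇒P ∘ (false ∷_)))
            (count-cong _ _ (P⇒Q ∘ (true ∷_)) (Q⇒P ∘ (true ∷_)))

count-∅ : {P : Pred (Vec Bool n) 0ℓ} → (P? : Decidable P) → (∀ v → ¬ P v) → count P? ≡ 0
count-∅ {zero}  P? ¬P rewrite dec-false (P? []) (¬P []) = refl
count-∅ {suc n} P? ¬P = cong₂ _+_ (count-∅ _ (¬P ∘ (false ∷_))) (count-∅ _ (¬P ∘ (true ∷_)))

2^n+2^n≡2^suc : ∀ n → 2 ^ n + 2 ^ n ≡ 2 ^ suc n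
2^n+2^n≡2^suc n = cong (2 ^ n +_) (sym (ℕₚ.+-identityʳ (2 ^ n)))

count-all : {P : Pred (Vec Bool n) 0ℓ} → (P? : Decidable P) → (∀ v → P v) → count P? ≡ 2 ^ n
count-all {zero}  P? allP rewrite dec-true (P? []) (allP []) = refl
count-all {suc n} P? allP = begin
  count (P? ∘ (false ∷_)) + count (P? ∘ (true ∷_))  ≡⟨ cong₂ _+_ (count-all _ (allP ∘ (false ∷_))) (count-all _ (allP ∘ (true ∷_))) ⟩
  2 ^ n + 2 ^ n                                      ≡⟨ 2^n+2^n≡2^suc n ⟩
  2 ^ suc n                                          ∎
  where open ≡-Reasoning

count-∪ : {P Q : Pred (Vec Bool n) 0ℓ} → (P? : Decidable P) (Q? : Decidable Q) → (∀ v → P v → Q v → ⊥) →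
          count (P? ∪? Q?) ≡ count P? + count Q?
count-∪ {zero} P? Q? disjoint with P? [] | Q? []
... | yes p | yes q = ⊥-elim (disjoint [] p q)
... | yes _ | no  _ = refl
... | no  _ | yes _ = refl
... | no  _ | no  _ = refl
count-∪ {suc n} P? Q? disjoint =
  trans (cong₂ _+_ (count-∪ _ _ (disjoint ∘ (false ∷_))) (count-∪ _ _ (disjoint ∘ (true ∷_))))
        (+-interchange (count (P? ∘ (false ∷_))) (count (Q? ∘ (false ∷_))) _ _)

count-∁ : {P : Pred (Vec Bool n) 0ℓ} → (P? : Decidable P) → count P? + count (∁? P?) ≡ 2 ^ n
count-∁ P? = trans (sym (count-∪ P? (∁? P?) (λ v p ¬p → ¬p p)))
                   (count-all (P? ∪? ∁? P?) (λ v → toSum (P? v)))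

count-mono : {P Q : Pred (Vec Bool n) 0ℓ} → (P? : Decidable P) (Q? : Decidable Q) → (∀ v → P v → Q v) → count P? ≤ count Q?
count-mono {zero} P? Q? P⇒Q with P? [] | Q? []
... | yes p | yes _ = s≤s z≤n
... | yes p | no ¬q = ⊥-elim (¬q (P⇒Q [] p))
... | no  _ | _     = z≤n
count-mono {suc n} P? Q? P⇒Q =
  ℕₚ.+-mono-≤ (count-mono _ _ (P⇒Q ∘ (false ∷_))) (count-mono _ _ (P⇒Q ∘ (true ∷_)))

count-translate : {P : Pred (Vec Bool n) 0ℓ} → (P? : Decidable P) (c : Vec Bool n) → count (λ v → P? (v ⊕ c)) ≡ count P?
count-translate {zero}  P? []          = refl
count-translate {suc n} P? (false ∷ c) =
  cong₂ _+_ (count-translate (P? ∘ (false ∷_)) c) (count-translate (P? ∘ (true ∷_)) c)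
count-translate {suc n} P? (true ∷ c)  =
  trans (cong₂ _+_ (count-translate (P? ∘ (true ∷_)) c) (count-translate (P? ∘ (false ∷_)) c))
        (ℕₚ.+-comm (count (P? ∘ (true ∷_))) (count (P? ∘ (false ∷_))))

private
  count-∷-same : (a : Bool) (c : Vec Bool n) → count (λ v → (a ∷ v) ≟ⱽ (a ∷ c)) ≡ count (_≟ⱽ c)
  count-∷-same a c = count-cong _ (_≟ⱽ c) (λ _ → proj₂ ∘ Vecₚ.∷-injective) (λ _ → cong (a ∷_))

  count-∷-other : {a b : Bool} → a ≢ b → (c : Vec Bool n) → count (λ v → (a ∷ v) ≟ⱽ (b ∷ c)) ≡ 0
  count-∷-other {a = a} {b} a≢b c = count-∅ (λ v → (a ∷ v) ≟ⱽ (b ∷ c)) (λ _ → a≢b ∘ proj₁ ∘ Vecₚ.∷-injective)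

count-≡ : (c : Vec Bool n) → count (_≟ⱽ c) ≡ 1
count-≡ []          = refl
count-≡ (false ∷ c) = cong₂ _+_ (trans (count-∷-same false c) (count-≡ c)) (count-∷-other (λ ()) c)
count-≡ (true ∷ c)  = cong₂ _+_ (count-∷-other (λ ()) c) (trans (count-∷-same true c) (count-≡ c))

Linear : (Vec Bool n → Vec Bool m) → Set
Linear f = ∀ u v → f (u ⊕ v) ≡ f u ⊕ f v

Linear⇒zeros↦zeros : (f : Vec Bool n → Vec Bool m) → Linear f → f (zeros n) ≡ zeros m
Linear⇒zeros↦zeros {n} f f-lin = begin
  f (zeros n)                 ≡⟨ cong f (⊕-self (zeros n)) ⟨
  f (zeros n ⊕ zeros n)       ≡⟨ f-lin (zeros n) (zeros n) ⟩
  f (zeros n) ⊕ f (zeros n)   ≡⟨ ⊕-self (f (zeros n)) ⟩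
  zeros _                     ∎
  where open ≡-Reasoning

Ker? : (f : Vec Bool n → Vec Bool m) → Decidable (λ v → f v ≡ zeros m)
Ker? f v = f v ≟ⱽ zeros _

Im? : (f : Vec Bool n → Vec Bool m) → Decidable (λ w → ∃ λ v → f v ≡ w)
Im? f w = anySubset? (λ v → f v ≟ⱽ w)

module _ (f : Vec Bool (suc n) → Vec Bool m) (f-lin : Linear f) where
  private
    g : Vec Bool n → Vec Bool m
    g = f ∘ (false ∷_)

    c : Vec Bool m
    c = f (true ∷ zeros n)

    g-lin : Linear g
    g-lin u v = f-lin (false ∷ u) (false ∷ v)

    f-true : ∀ v → f (true ∷ v) ≡ c ⊕ g v
    f-true v = trans (cong (λ u → f (true ∷ u)) (sym (⊕-identityˡ v))) (f-lin (true ∷ zeros n) (false ∷ v))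

    Im-f⇒ : ∀ w → ∃ (λ v → f v ≡ w) → ∃ (λ v → g v ≡ w) ⊎ ∃ (λ v → g v ≡ w ⊕ c)
    Im-f⇒ w (false ∷ v , fv≡w) = inj₁ (v , fv≡w)
    Im-f⇒ w (true ∷ v , fv≡w)  = inj₂ (v , ⊕-moveˡ c (g v) w (trans (sym (f-true v)) fv≡w))

    Im-f⇐ : ∀ w → ∃ (λ v → g v ≡ w) ⊎ ∃ (λ v → g v ≡ w ⊕ c) → ∃ (λ v → f v ≡ w)
    Im-f⇐ w (inj₁ (v , gv≡w))   = false ∷ v , gv≡w
    Im-f⇐ w (inj₂ (v , gv≡w⊕c)) = true ∷ v , trans (f-true v) (⊕-moveʳ c (g v) w gv≡w⊕c)

    c∈Im-g : ∀ {v₀} → g v₀ ≡ c →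
             count (Ker? f) ≡ count (Ker? g) + count (Ker? g) × count (Im? f) ≡ count (Im? g)
    c∈Im-g {v₀} gv₀≡c = cong (count (Ker? g) +_) ∣Ker-f-true∣ , ∣Im-f∣
      where
      open ≡-Reasoning
      f-true≡g : ∀ v → f (true ∷ v) ≡ g (v ⊕ v₀)
      f-true≡g v = begin
        f (true ∷ v)   ≡⟨ f-true v ⟩
        c ⊕ g v        ≡⟨ cong (_⊕ g v) gv₀≡c ⟨
        g v₀ ⊕ g v     ≡⟨ ⊕-comm (g v₀) (g v) ⟩
        g v ⊕ g v₀     ≡⟨ g-lin v v₀ ⟨
        g (v ⊕ v₀)     ∎
      ∣Ker-f-true∣ : count (Ker? f ∘ (true ∷_)) ≡ count (Ker? g)
      ∣Ker-f-true∣ = trans (count-cong (Ker? f ∘ (true ∷_)) (λ v → Ker? g (v ⊕ v₀))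
                                       (λ v eq → trans (sym (f-true≡g v)) eq) (λ v eq → trans (f-true≡g v) eq))
                           (count-translate (Ker? g) v₀)
      shift : ∀ w → ∃ (λ v → g v ≡ w) ⊎ ∃ (λ v → g v ≡ w ⊕ c) → ∃ (λ v → g v ≡ w)
      shift w (inj₁ im)           = im
      shift w (inj₂ (v , gv≡w⊕c)) = v ⊕ v₀ , (begin
        g (v ⊕ v₀)      ≡⟨ g-lin v v₀ ⟩
        g v ⊕ g v₀      ≡⟨ cong₂ _⊕_ gv≡w⊕c gv₀≡c ⟩
        (w ⊕ c) ⊕ c     ≡⟨ ⊕-cancelʳ c w ⟩
        w               ∎)
      ∣Im-f∣ : count (Im? f) ≡ count (Im? g)
      ∣Im-f∣ = count-cong (Im? f) (Im? g) (λ w → shift w ∘ Im-f⇒ w) (λ w → Im-f⇐ w ∘ inj₁)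

    c∉Im-g : (∀ v → g v ≢ c) →
             count (Ker? f) ≡ count (Ker? g) + 0 × count (Im? f) ≡ count (Im? g) + count (Im? g)
    c∉Im-g c∉im = cong (count (Ker? g) +_) ∣Ker-f-true∣ , ∣Im-f∣
      where
      open ≡-Reasoning
      ∣Ker-f-true∣ : count (Ker? f ∘ (true ∷_)) ≡ 0
      ∣Ker-f-true∣ = count-∅ (Ker? f ∘ (true ∷_)) λ v fv≡0 →
        c∉im v (trans (⊕-moveˡ c (g v) (zeros m) (trans (sym (f-true v)) fv≡0)) (⊕-identityˡ c))
      disjoint : ∀ w → ∃ (λ v → g v ≡ w) → ∃ (λ v → g v ≡ w ⊕ c) → ⊥
      disjoint w (v₁ , gv₁≡w) (v₂ , gv₂≡w⊕c) = c∉im (v₁ ⊕ v₂) (begin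
        g (v₁ ⊕ v₂)    ≡⟨ g-lin v₁ v₂ ⟩
        g v₁ ⊕ g v₂    ≡⟨ cong₂ _⊕_ gv₁≡w gv₂≡w⊕c ⟩
        w ⊕ (w ⊕ c)    ≡⟨ ⊕-cancelˡ w c ⟩
        c              ∎)
      ∣Im-f∣ : count (Im? f) ≡ count (Im? g) + count (Im? g)
      ∣Im-f∣ = begin
        count (Im? f)                                 ≡⟨ count-cong (Im? f) (Im? g ∪? (λ w → Im? g (w ⊕ c))) Im-f⇒ Im-f⇐ ⟩
        count (Im? g ∪? (λ w → Im? g (w ⊕ c)))        ≡⟨ count-∪ (Im? g) (λ w → Im? g (w ⊕ c)) disjoint ⟩
        count (Im? g) + count (λ w → Im? g (w ⊕ c))   ≡⟨ cong (count (Im? g) +_) (count-translate (Im? g) c) ⟩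
        count (Im? g) + count (Im? g)                 ∎

  rank-nullity-step : count (Ker? g) * count (Im? g) ≡ 2 ^ n →
                      count (Ker? f) * count (Im? f) ≡ 2 ^ suc n
  rank-nullity-step IH with anySubset? (λ v → g v ≟ⱽ c)
  ... | yes (v₀ , gv₀≡c) = let (∣Ker∣ , ∣Im∣) = c∈Im-g gv₀≡c in begin
    count (Ker? f) * count (Im? f)                          ≡⟨ cong₂ _*_ ∣Ker∣ ∣Im∣ ⟩
    (count (Ker? g) + count (Ker? g)) * count (Im? g)       ≡⟨ ℕₚ.*-distribʳ-+ (count (Im? g)) (count (Ker? g)) _ ⟩
    count (Ker? g) * count (Im? g) + count (Ker? g) * count (Im? g)
                                                            ≡⟨ cong₂ _+_ IH IH ⟩
    2 ^ n + 2 ^ n                                           ≡⟨ 2^n+2^n≡2^suc n ⟩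
    2 ^ suc n                                               ∎
    where open ≡-Reasoning
  ... | no c∉im = let (∣Ker∣ , ∣Im∣) = c∉Im-g (λ v gv≡c → c∉im (v , gv≡c)) in begin
    count (Ker? f) * count (Im? f)                          ≡⟨ cong₂ _*_ (trans ∣Ker∣ (ℕₚ.+-identityʳ _)) ∣Im∣ ⟩
    count (Ker? g) * (count (Im? g) + count (Im? g))        ≡⟨ ℕₚ.*-distribˡ-+ (count (Ker? g)) (count (Im? g)) _ ⟩
    count (Ker? g) * count (Im? g) + count (Ker? g) * count (Im? g)
                                                            ≡⟨ cong₂ _+_ IH IH ⟩
    2 ^ n + 2 ^ n                                           ≡⟨ 2^n+2^n≡2^suc n ⟩
    2 ^ suc n                                               ∎
    where open ≡-Reasoning

rank-nullity : (f : Vec Bool n → Vec Bool m) → Linear f → count (Ker? f) * count (Im? f) ≡ 2 ^ n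
rank-nullity {zero} {m} f f-lin =
  cong₂ _*_ (count-all (Ker? f) (λ { [] → f[]≡0 }))
            (trans (count-cong (Im? f) (_≟ⱽ zeros m) (λ { w ([] , f[]≡w) → trans (sym f[]≡w) f[]≡0 })
                                                     (λ w w≡0 → [] , trans f[]≡0 (sym w≡0)))
                   (count-≡ (zeros m)))
  where
  f[]≡0 : f [] ≡ zeros m
  f[]≡0 = Linear⇒zeros↦zeros f f-lin
rank-nullity {suc n} f f-lin =
  rank-nullity-step f f-lin (rank-nullity (f ∘ (false ∷_)) (λ u v → f-lin (false ∷ u) (false ∷ v)))

count-≡⇒⊇ : {P Q : Pred (Vec Bool n) 0ℓ} (P? : Decidable P) (Q? : Decidable Q) →
            (∀ v → P v → Q v) → count P? ≡ count Q? → ∀ v → Q v → P v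
count-≡⇒⊇ {n} {P} P? Q? P⊆Q ∣P∣≡∣Q∣ v Qv with P? v
... | yes Pv = Pv
... | no ¬Pv = ⊥-elim (ℕₚ.<-irrefl ∣P∣≡∣Q∣ (begin-strict
  count P?                         <⟨ ℕₚ.n<1+n (count P?) ⟩
  suc (count P?)                   ≡⟨ ℕₚ.+-comm 1 (count P?) ⟩
  count P? + 1                     ≡⟨ cong (count P? +_) (count-≡ v) ⟨
  count P? + count (_≟ⱽ v)         ≡⟨ count-∪ P? (_≟ⱽ v) (λ { u Pu refl → ¬Pv Pu }) ⟨
  count (P? ∪? (_≟ⱽ v))            ≤⟨ count-mono (P? ∪? (_≟ⱽ v)) Q? (λ { u (inj₁ Pu) → P⊆Q u Pu ; u (inj₂ refl) → Qv }) ⟩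
  count Q?                         ∎))
  where open ℕₚ.≤-Reasoning

xor≡false⇒≡ : ∀ {a b} → a xor b ≡ false → a ≡ b
xor≡false⇒≡ {false} {false} _ = refl
xor≡false⇒≡ {true}  {true}  _ = refl

xor≡true⇒≡not : ∀ {a b} → a xor b ≡ true → b ≡ not a
xor≡true⇒≡not {false} eq = eq
xor≡true⇒≡not {true} {false} _ = refl

xor-cycle : ∀ a b c → (a xor b) xor ((b xor c) xor (c xor a)) ≡ false
xor-cycle false false false = refl
xor-cycle false false true  = refl
xor-cycle false true  false = refl
xor-cycle false true  true  = refl
xor-cycle true  false false = refl
xor-cycle true  false true  = refl
xor-cycle true  true  false = refl
xor-cycle true  true  true  = refl

infix 4 _≡ᵇ_

_≡ᵇ_ : ∀ {n} → Fin n → Fin n → Bool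
i ≡ᵇ j = does (i ≟ j)

≡ᵇ-refl : ∀ {n} (i : Fin n) → (i ≡ᵇ i) ≡ true
≡ᵇ-refl i = dec-true (i ≟ i) refl

≢⇒≡ᵇ-false : ∀ {n} {i j : Fin n} → i ≢ j → (i ≡ᵇ j) ≡ false
≢⇒≡ᵇ-false {i = i} {j} = dec-false (i ≟ j)

≡ᵇ-sym : ∀ {n} (i j : Fin n) → (i ≡ᵇ j) ≡ (j ≡ᵇ i)
≡ᵇ-sym i j = does-⇔ (mk⇔ sym sym) (i ≟ j) (j ≟ i)

unit : ∀ {n} → Fin n → Vec Bool n
unit j = tabulate (_≡ᵇ j)

lookup-unit : ∀ {n} (j i : Fin n) → lookup (unit j) i ≡ (i ≡ᵇ j)
lookup-unit j i = Vecₚ.lookup∘tabulate (_≡ᵇ j) i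

∑-indicator : ∀ {n} (j : Fin n) (f : Fin n → Bool) → ∑[ i < n ] ((i ≡ᵇ j) ∧ f i) ≡ f j
∑-indicator {suc n} zero    f = trans (cong (f zero xor_) (sum-replicate-zero n)) (Boolₚ.xor-identityʳ (f zero))
∑-indicator {suc n} (suc j) f = ∑-indicator j (f ∘ suc)

∑-indicatorʳ : ∀ {n} (j : Fin n) (f : Fin n → Bool) → ∑[ i < n ] ((j ≡ᵇ i) ∧ f i) ≡ f j
∑-indicatorʳ j f = trans (sum-cong-≗ (λ i → cong (_∧ f i) (≡ᵇ-sym j i))) (∑-indicator j f)

∑-≡ᵇ : ∀ {n} (j : Fin n) → ∑[ i < n ] (i ≡ᵇ j) ≡ true
∑-≡ᵇ j = trans (sum-cong-≗ (λ i → sym (Boolₚ.∧-identityʳ (i ≡ᵇ j)))) (∑-indicator j (λ _ → true))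

-- Combinatorial maps

module _ {D : Set} {k : ℕ} {π : D → D} {ℓ : D → Fin k} (orbits : OrbitLabel π ℓ) where

  orbit-label-π : ∀ x → ℓ (π x) ≡ ℓ x
  orbit-label-π x = sym (Equivalence.from (proj₁ orbits x (π x)) (1 , refl))

  orbit-same-label : ∀ {x y} → ℓ x ≡ ℓ y → ∃ λ i → iter π i x ≡ y
  orbit-same-label {x} {y} = Equivalence.to (proj₁ orbits x y)

  orbitRep : Fin k → D
  orbitRep c = proj₁ (proj₂ orbits c)

  orbitRep-label : ∀ c → ℓ (orbitRep c) ≡ c
  orbitRep-label c = proj₂ (proj₂ orbits c)

module _ {D : Set} {π : D → D} where

  iter-involution : (∀ x → π (π x) ≡ x) → ∀ i x → iter π i x ≡ x ⊎ iter π i x ≡ π x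
  iter-involution invol zero    x = inj₁ refl
  iter-involution invol (suc i) x with iter-involution invol i x
  ... | inj₁ eq = inj₂ (cong π eq)
  ... | inj₂ eq = inj₁ (trans (cong π eq) (invol x))

  iter-period3 : ∀ {x} → iter π 3 x ≡ x → ∀ i →
                 iter π i x ≡ x ⊎ iter π i x ≡ π x ⊎ iter π i x ≡ π (π x)
  iter-period3 π³x≡x zero    = inj₁ refl
  iter-period3 π³x≡x (suc i) with iter-period3 π³x≡x i
  ... | inj₁ eq        = inj₂ (inj₁ (cong π eq))
  ... | inj₂ (inj₁ eq) = inj₂ (inj₂ (cong π eq))
  ... | inj₂ (inj₂ eq) = inj₁ (trans (cong π eq) π³x≡x)

module _ (M : PlaneGraph) where

  vtx-σ : ∀ x → vtx M (σ M x) ≡ vtx M x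
  vtx-σ = orbit-label-π (vtx-orb M)

  edge-α : ∀ x → edge M (α M x) ≡ edge M x
  edge-α = orbit-label-π (edge-orb M)

  face-φ : ∀ x → face M (φ M x) ≡ face M x
  face-φ = orbit-label-π (face-orb M)

  vtx-α≡vtx-φ : ∀ x → vtx M (α M x) ≡ vtx M (φ M x)
  vtx-α≡vtx-φ x = sym (vtx-σ (α M x))

  face-σ : ∀ x → face M (σ M x) ≡ face M (α M x)
  face-σ x = trans (cong (face M ∘ σ M) (sym (α-invol M x))) (face-φ (α M x))

  φ-injective : ∀ {x y} → φ M x ≡ φ M y → x ≡ y
  φ-injective {x} {y} eq = trans (sym (α-invol M x)) (trans (cong (α M) (σ-inj M eq)) (α-invol M y))

  same-edge : ∀ {x y} → edge M x ≡ edge M y → y ≡ x ⊎ y ≡ α M x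
  same-edge {x} eq with orbit-same-label (edge-orb M) eq
  ... | i , iterᵢx≡y with iter-involution (α-invol M) i x
  ...   | inj₁ eq′ = inj₁ (trans (sym iterᵢx≡y) eq′)
  ...   | inj₂ eq′ = inj₂ (trans (sym iterᵢx≡y) eq′)

  vertexDart : Fin (nv M) → Dart M
  vertexDart = orbitRep (vtx-orb M)

  edgeDart : Fin (ne M) → Dart M
  edgeDart = orbitRep (edge-orb M)

  faceDart : Fin (nf M) → Dart M
  faceDart = orbitRep (face-orb M)

  onEdges : {A : Set} → (Dart M → A) → Fin (ne M) → A
  onEdges h = h ∘ edgeDart

  onEdges-edge : {A : Set} (h : Dart M → A) → (∀ x → h (α M x) ≡ h x) → ∀ x → onEdges h (edge M x) ≡ h x
  onEdges-edge h h-α x with same-edge (orbitRep-label (edge-orb M) (edge M x))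
  ... | inj₁ x≡y  = cong h (sym x≡y)
  ... | inj₂ x≡αy = trans (sym (h-α _)) (cong h (sym x≡αy))

  edge-indicator : ∀ z y → (edge M z ≡ᵇ edge M y) ≡ (z ≡ᵇ y) xor (z ≡ᵇ α M y)
  edge-indicator z y with edge M z ≟ edge M y
  ... | yes eq with same-edge (sym eq)
  ...   | inj₁ refl = sym (cong₂ _xor_ (≡ᵇ-refl z) (≢⇒≡ᵇ-false (λ z≡αz → α-fpf M z (sym z≡αz))))
  ...   | inj₂ refl = sym (cong₂ _xor_ (≢⇒≡ᵇ-false (α-fpf M y)) (≡ᵇ-refl (α M y)))
  edge-indicator z y | no neq =
    sym (cong₂ _xor_ (≢⇒≡ᵇ-false (neq ∘ cong (edge M)))
                     (≢⇒≡ᵇ-false (λ z≡αy → neq (trans (cong (edge M) z≡αy) (edge-α y)))))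

  module _ {x : Dart M} (tri : IsTri M x) where
    private
      x₁ x₂ : Dart M
      x₁ = φ M x
      x₂ = φ M (φ M x)

      x₁≢x : x₁ ≢ x
      x₁≢x = proj₂ tri

      x₂≢x : x₂ ≢ x
      x₂≢x x₂≡x = x₁≢x (trans (sym (cong (φ M) x₂≡x)) (proj₁ tri))

      x₂≢x₁ : x₂ ≢ x₁
      x₂≢x₁ = x₁≢x ∘ φ-injective

    vtx-α-φ² : vtx M (α M x₂) ≡ vtx M x
    vtx-α-φ² = trans (vtx-α≡vtx-φ x₂) (cong (vtx M) (proj₁ tri))

    triangle-face : ∀ z → face M z ≡ face M x → z ≡ x ⊎ z ≡ x₁ ⊎ z ≡ x₂
    triangle-face z eq with orbit-same-label (face-orb M) (sym eq)
    ... | i , iterᵢx≡z with iter-period3 (proj₁ tri) i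
    ...   | inj₁ e        = inj₁ (trans (sym iterᵢx≡z) e)
    ...   | inj₂ (inj₁ e) = inj₂ (inj₁ (trans (sym iterᵢx≡z) e))
    ...   | inj₂ (inj₂ e) = inj₂ (inj₂ (trans (sym iterᵢx≡z) e))

    face-indicator : ∀ z → (face M z ≡ᵇ face M x) ≡ (z ≡ᵇ x) xor ((z ≡ᵇ x₁) xor (z ≡ᵇ x₂))
    face-indicator z with face M z ≟ face M x
    ... | yes eq with triangle-face z eq
    ...   | inj₁ refl = sym (cong₂ _xor_ (≡ᵇ-refl x)
                              (cong₂ _xor_ (≢⇒≡ᵇ-false (x₁≢x ∘ sym)) (≢⇒≡ᵇ-false (x₂≢x ∘ sym))))
    ...   | inj₂ (inj₁ refl) = sym (cong₂ _xor_ (≢⇒≡ᵇ-false x₁≢x)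
                                     (cong₂ _xor_ (≡ᵇ-refl x₁) (≢⇒≡ᵇ-false (x₂≢x₁ ∘ sym))))
    ...   | inj₂ (inj₂ refl) = sym (cong₂ _xor_ (≢⇒≡ᵇ-false x₂≢x)
                                     (cong₂ _xor_ (≢⇒≡ᵇ-false x₂≢x₁) (≡ᵇ-refl x₂)))
    face-indicator z | no neq =
      sym (cong₂ _xor_ (≢⇒≡ᵇ-false (neq ∘ cong (face M)))
                       (cong₂ _xor_ (≢⇒≡ᵇ-false (λ z≡x₁ → neq (trans (cong (face M) z≡x₁) (face-φ x))))
                                    (≢⇒≡ᵇ-false (λ z≡x₂ → neq (trans (cong (face M) z≡x₂)
                                                                     (trans (face-φ x₁) (face-φ x)))))))

    ∑-triangle : (h : Dart M → Bool) →
                 ∑[ z < nd M ] ((face M z ≡ᵇ face M x) ∧ h z) ≡ h x xor (h x₁ xor h x₂)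
    ∑-triangle h = begin
      ∑[ z < nd M ] ((face M z ≡ᵇ face M x) ∧ h z)
        ≡⟨ sum-cong-≗ (λ z → trans (cong (_∧ h z) (face-indicator z)) (distrib z)) ⟩
      ∑[ z < nd M ] (((z ≡ᵇ x) ∧ h z) xor (((z ≡ᵇ x₁) ∧ h z) xor ((z ≡ᵇ x₂) ∧ h z)))
        ≡⟨ ∑-distrib-+ (λ z → (z ≡ᵇ x) ∧ h z) _ ⟩
      h′ x xor ∑[ z < nd M ] (((z ≡ᵇ x₁) ∧ h z) xor ((z ≡ᵇ x₂) ∧ h z))
        ≡⟨ cong₂ _xor_ (∑-indicator x h) (∑-distrib-+ (λ z → (z ≡ᵇ x₁) ∧ h z) _) ⟩
      h x xor (h′ x₁ xor h′ x₂)
        ≡⟨ cong (h x xor_) (cong₂ _xor_ (∑-indicator x₁ h) (∑-indicator x₂ h)) ⟩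
      h x xor (h x₁ xor h x₂) ∎
      where
      open ≡-Reasoning
      h′ : Dart M → Bool
      h′ y = ∑[ z < nd M ] ((z ≡ᵇ y) ∧ h z)
      distrib : ∀ z → ((z ≡ᵇ x) xor ((z ≡ᵇ x₁) xor (z ≡ᵇ x₂))) ∧ h z
                    ≡ ((z ≡ᵇ x) ∧ h z) xor (((z ≡ᵇ x₁) ∧ h z) xor ((z ≡ᵇ x₂) ∧ h z))
      distrib z = trans (Boolₚ.∧-distribʳ-xor (h z) (z ≡ᵇ x) _)
                        (cong (((z ≡ᵇ x) ∧ h z) xor_) (Boolₚ.∧-distribʳ-xor (h z) (z ≡ᵇ x₁) _))

parity : ∀ {n} → Vec Bool n → Bool
parity {n} w = ∑[ i < n ] lookup w i

Even? : ∀ {n} → Decidable (λ (w : Vec Bool n) → parity w ≡ false)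
Even? w = parity w Boolₚ.≟ false

count-even : ∀ {n} → Fin n → 2 * count (Even? {n}) ≡ 2 ^ n
count-even {suc n} _ = cong (2 *_) (begin
  count (Even? {n}) + count (λ (w : Vec Bool n) → not (parity w) Boolₚ.≟ false)
    ≡⟨ cong (count (Even? {n}) +_)
            (count-cong (λ (w : Vec Bool n) → not (parity w) Boolₚ.≟ false) (∁? (Even? {n}))
                        (λ w → not≡false⇒≢false) (λ w → ≢false⇒not≡false)) ⟩
  count (Even? {n}) + count (∁? (Even? {n}))
    ≡⟨ count-∁ (Even? {n}) ⟩
  2 ^ n ∎)
  where
  open ≡-Reasoning
  not≡false⇒≢false : ∀ {b} → not b ≡ false → b ≢ false
  not≡false⇒≢false {true} _ ()
  ≢false⇒not≡false : ∀ {b} → b ≢ false → not b ≡ false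
  ≢false⇒not≡false {false} b≢false = ⊥-elim (b≢false refl)
  ≢false⇒not≡false {true}  _       = refl

parity-concentrated : ∀ {n} (w : Vec Bool n) j → (∀ i → i ≢ j → lookup w i ≡ false) → parity w ≡ lookup w j
parity-concentrated {n} w j off-j = trans (sum-cong-≗ concentrate) (∑-indicator j (lookup w))
  where
  concentrate : ∀ i → lookup w i ≡ (i ≡ᵇ j) ∧ lookup w i
  concentrate i with i ≟ j
  ... | yes _  = refl
  ... | no i≢j = off-j i i≢j

-- The coboundary δ and the boundary ∂ of a plane map

module _ (M : PlaneGraph) where

  dartDiff : Vec Bool (nv M) → Dart M → Bool
  dartDiff f x = lookup f (vtx M x) xor lookup f (vtx M (α M x))

  dartDiff-α : ∀ f x → dartDiff f (α M x) ≡ dartDiff f x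
  dartDiff-α f x = trans (cong (λ y → lookup f (vtx M (α M x)) xor lookup f (vtx M y)) (α-invol M x))
                         (Boolₚ.xor-comm (lookup f (vtx M (α M x))) (lookup f (vtx M x)))

  δ : Vec Bool (nv M) → Vec Bool (ne M)
  δ f = tabulate (onEdges M (dartDiff f))

  δ-edge : ∀ f x → lookup (δ f) (edge M x) ≡ dartDiff f x
  δ-edge f x = trans (Vecₚ.lookup∘tabulate _ (edge M x)) (onEdges-edge M (dartDiff f) (dartDiff-α f) x)

  δ-linear : Linear δ
  δ-linear u v = lookup-ext pointwise
    where
    pointwise : ∀ e → lookup (δ (u ⊕ v)) e ≡ lookup (δ u ⊕ δ v) e
    pointwise e = begin
      lookup (δ (u ⊕ v)) e                                   ≡⟨ Vecₚ.lookup∘tabulate _ e ⟩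
      (lookup (u ⊕ v) (vtx M x)) xor (lookup (u ⊕ v) (vtx M (α M x)))
        ≡⟨ cong₂ _xor_ (lookup-⊕ u v (vtx M x)) (lookup-⊕ u v (vtx M (α M x))) ⟩
      (lookup u (vtx M x) xor lookup v (vtx M x)) xor (lookup u (vtx M (α M x)) xor lookup v (vtx M (α M x)))
        ≡⟨ xor-interchange (lookup u (vtx M x)) (lookup v (vtx M x)) (lookup u (vtx M (α M x))) _ ⟩
      dartDiff u x xor dartDiff v x                          ≡⟨ cong₂ _xor_ (Vecₚ.lookup∘tabulate _ e) (Vecₚ.lookup∘tabulate _ e) ⟨
      lookup (δ u) e xor lookup (δ v) e                      ≡⟨ lookup-⊕ (δ u) (δ v) e ⟨
      lookup (δ u ⊕ δ v) e                                   ∎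
      where
      open ≡-Reasoning
      x : Dart M
      x = edgeDart M e

  ∂ : Vec Bool (ne M) → Vec Bool (nf M)
  ∂ g = tabulate λ F → ∑[ z < nd M ] ((face M z ≡ᵇ F) ∧ lookup g (edge M z))

  ∂-lookup : ∀ g F → lookup (∂ g) F ≡ ∑[ z < nd M ] ((face M z ≡ᵇ F) ∧ lookup g (edge M z))
  ∂-lookup g F = Vecₚ.lookup∘tabulate _ F

  ∂-linear : Linear ∂
  ∂-linear u v = lookup-ext λ F → begin
    lookup (∂ (u ⊕ v)) F
      ≡⟨ ∂-lookup (u ⊕ v) F ⟩
    ∑[ z < nd M ] ((face M z ≡ᵇ F) ∧ lookup (u ⊕ v) (edge M z))
      ≡⟨ sum-cong-≗ (λ z → trans (cong ((face M z ≡ᵇ F) ∧_) (lookup-⊕ u v (edge M z)))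
                                 (Boolₚ.∧-distribˡ-xor (face M z ≡ᵇ F) _ _)) ⟩
    ∑[ z < nd M ] (((face M z ≡ᵇ F) ∧ lookup u (edge M z)) xor ((face M z ≡ᵇ F) ∧ lookup v (edge M z)))
      ≡⟨ ∑-distrib-+ (λ z → (face M z ≡ᵇ F) ∧ lookup u (edge M z)) _ ⟩
    ∑[ z < nd M ] ((face M z ≡ᵇ F) ∧ lookup u (edge M z)) xor ∑[ z < nd M ] ((face M z ≡ᵇ F) ∧ lookup v (edge M z))
      ≡⟨ cong₂ _xor_ (∂-lookup u F) (∂-lookup v F) ⟨
    lookup (∂ u) F xor lookup (∂ v) F
      ≡⟨ lookup-⊕ (∂ u) (∂ v) F ⟨
    lookup (∂ u ⊕ ∂ v) F ∎
    where open ≡-Reasoning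

  ∂-triangle : ∀ g {x} → IsTri M x →
               lookup (∂ g) (face M x)
                 ≡ lookup g (edge M x) xor (lookup g (edge M (φ M x)) xor lookup g (edge M (φ M (φ M x))))
  ∂-triangle g tri = trans (∂-lookup g _) (∑-triangle M tri (lookup g ∘ edge M))

  ∑-edge-darts : ∀ e → ∑[ z < nd M ] (edge M z ≡ᵇ e) ≡ false
  ∑-edge-darts e = begin
    ∑[ z < nd M ] (edge M z ≡ᵇ e)
      ≡⟨ sum-cong-≗ (λ z → trans (cong (edge M z ≡ᵇ_) (sym (orbitRep-label (edge-orb M) e))) (edge-indicator M z y)) ⟩
    ∑[ z < nd M ] ((z ≡ᵇ y) xor (z ≡ᵇ α M y))
      ≡⟨ ∑-distrib-+ (_≡ᵇ y) (_≡ᵇ α M y) ⟩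
    ∑[ z < nd M ] (z ≡ᵇ y) xor ∑[ z < nd M ] (z ≡ᵇ α M y)
      ≡⟨ cong₂ _xor_ (∑-≡ᵇ y) (∑-≡ᵇ (α M y)) ⟩
    false ∎
    where
    open ≡-Reasoning
    y : Dart M
    y = edgeDart M e

  ∂-parity : ∀ g → parity (∂ g) ≡ false
  ∂-parity g = begin
    ∑[ F < nf M ] lookup (∂ g) F
      ≡⟨ sum-cong-≗ (∂-lookup g) ⟩
    ∑[ F < nf M ] ∑[ z < nd M ] ((face M z ≡ᵇ F) ∧ g′ z)
      ≡⟨ ∑-comm (λ F z → (face M z ≡ᵇ F) ∧ g′ z) ⟩
    ∑[ z < nd M ] ∑[ F < nf M ] ((face M z ≡ᵇ F) ∧ g′ z)
      ≡⟨ sum-cong-≗ (λ z → ∑-indicatorʳ (face M z) (λ _ → g′ z)) ⟩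
    ∑[ z < nd M ] g′ z
      ≡⟨ sum-cong-≗ (λ z → sym (∑-indicator (edge M z) (lookup g))) ⟩
    ∑[ z < nd M ] ∑[ e < ne M ] ((e ≡ᵇ edge M z) ∧ lookup g e)
      ≡⟨ ∑-comm (λ z e → (e ≡ᵇ edge M z) ∧ lookup g e) ⟩
    ∑[ e < ne M ] ∑[ z < nd M ] ((e ≡ᵇ edge M z) ∧ lookup g e)
      ≡⟨ sum-cong-≗ (λ e → sym (*-distribʳ-sum (lookup g e) (λ z → e ≡ᵇ edge M z))) ⟩
    ∑[ e < ne M ] (∑[ z < nd M ] (e ≡ᵇ edge M z) ∧ lookup g e)
      ≡⟨ sum-cong-≗ (λ e → cong (_∧ lookup g e) (trans (sum-cong-≗ (λ z → ≡ᵇ-sym e (edge M z))) (∑-edge-darts e))) ⟩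
    ∑[ e < ne M ] false
      ≡⟨ sum-replicate-zero (ne M) ⟩
    false ∎
    where
    open ≡-Reasoning
    g′ : Dart M → Bool
    g′ z = lookup g (edge M z)

  ∂-unit : ∀ y → ∂ (unit (edge M y)) ≡ unit (face M y) ⊕ unit (face M (α M y))
  ∂-unit y = lookup-ext pointwise
    where
    pointwise : ∀ G → lookup (∂ (unit (edge M y))) G ≡ lookup (unit (face M y) ⊕ unit (face M (α M y))) G
    pointwise G = begin
      lookup (∂ (unit (edge M y))) G
        ≡⟨ ∂-lookup (unit (edge M y)) G ⟩
      ∑[ z < nd M ] ((face M z ≡ᵇ G) ∧ lookup (unit (edge M y)) (edge M z))
        ≡⟨ sum-cong-≗ (λ z → cong ((face M z ≡ᵇ G) ∧_) (trans (lookup-unit (edge M y) (edge M z)) (edge-indicator M z y))) ⟩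
      ∑[ z < nd M ] ((face M z ≡ᵇ G) ∧ ((z ≡ᵇ y) xor (z ≡ᵇ α M y)))
        ≡⟨ sum-cong-≗ (λ z → trans (Boolₚ.∧-distribˡ-xor (face M z ≡ᵇ G) (z ≡ᵇ y) _)
                                   (cong₂ _xor_ (Boolₚ.∧-comm (face M z ≡ᵇ G) _) (Boolₚ.∧-comm (face M z ≡ᵇ G) _))) ⟩
      ∑[ z < nd M ] (((z ≡ᵇ y) ∧ (face M z ≡ᵇ G)) xor ((z ≡ᵇ α M y) ∧ (face M z ≡ᵇ G)))
        ≡⟨ ∑-distrib-+ (λ z → (z ≡ᵇ y) ∧ (face M z ≡ᵇ G)) _ ⟩
      ∑[ z < nd M ] ((z ≡ᵇ y) ∧ (face M z ≡ᵇ G)) xor ∑[ z < nd M ] ((z ≡ᵇ α M y) ∧ (face M z ≡ᵇ G))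
        ≡⟨ cong₂ _xor_ (∑-indicator y (λ z → face M z ≡ᵇ G)) (∑-indicator (α M y) (λ z → face M z ≡ᵇ G)) ⟩
      (face M y ≡ᵇ G) xor (face M (α M y) ≡ᵇ G)
        ≡⟨ cong₂ _xor_ (trans (≡ᵇ-sym _ G) (sym (lookup-unit (face M y) G)))
                       (trans (≡ᵇ-sym _ G) (sym (lookup-unit (face M (α M y)) G))) ⟩
      lookup (unit (face M y)) G xor lookup (unit (face M (α M y))) G
        ≡⟨ lookup-⊕ (unit (face M y)) _ G ⟨
      lookup (unit (face M y) ⊕ unit (face M (α M y))) G ∎
      where open ≡-Reasoning

module _ (M : PlaneGraph) where

  reach⇒boundary : ∀ {x y} → Reach (α M) (σ M) x y → ∃ λ g → ∂ M g ≡ unit (face M x) ⊕ unit (face M y)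
  reach⇒boundary {x} here = zeros _ , trans (Linear⇒zeros↦zeros (∂ M) (∂-linear M)) (sym (⊕-self (unit (face M x))))
  reach⇒boundary {x} (viaα {y} r) with reach⇒boundary r
  ... | g , ∂g = g ⊕ unit (edge M y) , (begin
    ∂ M (g ⊕ unit (edge M y))                                       ≡⟨ ∂-linear M g _ ⟩
    ∂ M g ⊕ ∂ M (unit (edge M y))                                   ≡⟨ cong₂ _⊕_ ∂g (∂-unit M y) ⟩
    (unit (face M x) ⊕ unit (face M y)) ⊕ (unit (face M y) ⊕ unit (face M (α M y)))
                                                                    ≡⟨ ⊕-telescope _ _ _ ⟩
    unit (face M x) ⊕ unit (face M (α M y))                         ∎)
    where open ≡-Reasoning
  reach⇒boundary {x} (viaσ {y} r) with reach⇒boundary (viaα r)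
  ... | g , ∂g = g , trans ∂g (cong (λ F → unit (face M x) ⊕ unit F) (sym (face-σ M y)))

  face-pair-boundary : (x : Dart M) (F : Fin (nf M)) → ∃ λ g → ∂ M g ≡ unit (face M x) ⊕ unit F
  face-pair-boundary x F =
    let (g , ∂g) = reach⇒boundary (connected M x (faceDart M F)) in
    g , trans ∂g (cong (λ F′ → unit (face M x) ⊕ unit F′) (orbitRep-label (face-orb M) F))

  even⇒boundary : Dart M → ∀ w → parity w ≡ false → ∃ λ g → ∂ M g ≡ w
  even⇒boundary x w even = g , lookup-ext pointwise
    where
    open ≡-Reasoning
    F* : Fin (nf M)
    F* = face M x

    chain : Fin (nf M) → Vec Bool (ne M)
    chain F = proj₁ (face-pair-boundary x F)

    ∂chain : ∀ F G → lookup (∂ M (chain F)) G ≡ (G ≡ᵇ F*) xor (G ≡ᵇ F)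
    ∂chain F G = trans (cong (λ v → lookup v G) (proj₂ (face-pair-boundary x F)))
                       (trans (lookup-⊕ (unit F*) (unit F) G) (cong₂ _xor_ (lookup-unit F* G) (lookup-unit F G)))

    g : Vec Bool (ne M)
    g = tabulate λ e → ∑[ F < nf M ] (lookup w F ∧ lookup (chain F) e)

    pointwise : ∀ G → lookup (∂ M g) G ≡ lookup w G
    pointwise G = begin
      lookup (∂ M g) G
        ≡⟨ ∂-lookup M g G ⟩
      ∑[ z < nd M ] ((face M z ≡ᵇ G) ∧ lookup g (edge M z))
        ≡⟨ sum-cong-≗ (λ z → trans (cong ((face M z ≡ᵇ G) ∧_) (Vecₚ.lookup∘tabulate _ (edge M z)))
                                   (*-distribˡ-sum (face M z ≡ᵇ G) (λ F → lookup w F ∧ lookup (chain F) (edge M z)))) ⟩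
      ∑[ z < nd M ] ∑[ F < nf M ] ((face M z ≡ᵇ G) ∧ (lookup w F ∧ lookup (chain F) (edge M z)))
        ≡⟨ ∑-comm (λ z F → (face M z ≡ᵇ G) ∧ (lookup w F ∧ lookup (chain F) (edge M z))) ⟩
      ∑[ F < nf M ] ∑[ z < nd M ] ((face M z ≡ᵇ G) ∧ (lookup w F ∧ lookup (chain F) (edge M z)))
        ≡⟨ sum-cong-≗ (λ F → trans (sum-cong-≗ (λ z → ∧-left-swap (face M z ≡ᵇ G) (lookup w F) (lookup (chain F) (edge M z))))
                                   (sym (*-distribˡ-sum (lookup w F) (λ z → (face M z ≡ᵇ G) ∧ lookup (chain F) (edge M z))))) ⟩
      ∑[ F < nf M ] (lookup w F ∧ ∑[ z < nd M ] ((face M z ≡ᵇ G) ∧ lookup (chain F) (edge M z)))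
        ≡⟨ sum-cong-≗ (λ F → cong (lookup w F ∧_) (trans (sym (∂-lookup M (chain F) G)) (∂chain F G))) ⟩
      ∑[ F < nf M ] (lookup w F ∧ ((G ≡ᵇ F*) xor (G ≡ᵇ F)))
        ≡⟨ sum-cong-≗ (λ F → Boolₚ.∧-distribˡ-xor (lookup w F) (G ≡ᵇ F*) (G ≡ᵇ F)) ⟩
      ∑[ F < nf M ] ((lookup w F ∧ (G ≡ᵇ F*)) xor (lookup w F ∧ (G ≡ᵇ F)))
        ≡⟨ ∑-distrib-+ (λ F → lookup w F ∧ (G ≡ᵇ F*)) _ ⟩
      ∑[ F < nf M ] (lookup w F ∧ (G ≡ᵇ F*)) xor ∑[ F < nf M ] (lookup w F ∧ (G ≡ᵇ F))
        ≡⟨ cong₂ _xor_ (sym (*-distribʳ-sum (G ≡ᵇ F*) (lookup w)))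
                       (trans (sum-cong-≗ (λ F → Boolₚ.∧-comm (lookup w F) (G ≡ᵇ F))) (∑-indicatorʳ G (lookup w))) ⟩
      (∑[ F < nf M ] lookup w F ∧ (G ≡ᵇ F*)) xor lookup w G
        ≡⟨ cong (λ b → (b ∧ (G ≡ᵇ F*)) xor lookup w G) even ⟩
      lookup w G ∎

  δ≡zeros⇒reach-constant : ∀ f → δ M f ≡ zeros (ne M) →
                            ∀ {x y} → Reach (α M) (σ M) x y → lookup f (vtx M x) ≡ lookup f (vtx M y)
  δ≡zeros⇒reach-constant f δf≡0 here        = refl
  δ≡zeros⇒reach-constant f δf≡0 (viaα {y} r) =
    trans (δ≡zeros⇒reach-constant f δf≡0 r) (xor≡false⇒≡ (trans (sym (δ-edge M f y)) δf≡0-at-y))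
    where
    δf≡0-at-y : lookup (δ M f) (edge M y) ≡ false
    δf≡0-at-y = trans (cong (λ v → lookup v (edge M y)) δf≡0) (Vecₚ.lookup-replicate (edge M y) false)
  δ≡zeros⇒reach-constant f δf≡0 (viaσ {y} r) =
    trans (δ≡zeros⇒reach-constant f δf≡0 r) (cong (lookup f) (sym (vtx-σ M y)))

  δ-replicate : ∀ b → δ M (replicate (nv M) b) ≡ zeros (ne M)
  δ-replicate b = lookup-ext pointwise
    where
    open ≡-Reasoning
    pointwise : ∀ e → lookup (δ M (replicate (nv M) b)) e ≡ lookup (zeros (ne M)) e
    pointwise e = begin
      lookup (δ M (replicate (nv M) b)) e  ≡⟨ Vecₚ.lookup∘tabulate _ e ⟩
      dartDiff M (replicate (nv M) b) y    ≡⟨ cong₂ _xor_ (Vecₚ.lookup-replicate (vtx M y) b) (Vecₚ.lookup-replicate (vtx M (α M y)) b) ⟩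
      b xor b                              ≡⟨ Boolₚ.xor-same b ⟩
      false                                ≡⟨ Vecₚ.lookup-replicate e false ⟨
      lookup (zeros (ne M)) e              ∎
      where
      y : Dart M
      y = edgeDart M e

  ∣ker-δ∣≡2 : Dart M → count (Ker? (δ M)) ≡ 2
  ∣ker-δ∣≡2 x = begin
    count (Ker? (δ M))                            ≡⟨ count-cong (Ker? (δ M)) (_≟ⱽ zeros (nv M) ∪? _≟ⱽ ones) ker⇒const const⇒ker ⟩
    count (_≟ⱽ zeros (nv M) ∪? _≟ⱽ ones)          ≡⟨ count-∪ (_≟ⱽ zeros (nv M)) (_≟ⱽ ones) zeros≢ones ⟩
    count (_≟ⱽ zeros (nv M)) + count (_≟ⱽ ones)   ≡⟨ cong₂ _+_ (count-≡ (zeros (nv M))) (count-≡ ones) ⟩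
    2                                             ∎
    where
    open ≡-Reasoning

    false≢true : false ≢ true
    false≢true ()

    ones : Vec Bool (nv M)
    ones = replicate (nv M) true

    zeros≢ones : ∀ f → f ≡ zeros (nv M) → f ≡ ones → ⊥
    zeros≢ones f refl eq = false≢true (trans (sym (Vecₚ.lookup-replicate (vtx M x) false))
                                              (trans (cong (λ v → lookup v (vtx M x)) eq) (Vecₚ.lookup-replicate (vtx M x) true)))

    f≡replicate : ∀ f → δ M f ≡ zeros (ne M) → f ≡ replicate (nv M) (lookup f (vtx M x))
    f≡replicate f δf≡0 = lookup-ext λ u → begin
      lookup f u                    ≡⟨ cong (lookup f) (orbitRep-label (vtx-orb M) u) ⟨
      lookup f (vtx M (vertexDart M u))
                                    ≡⟨ δ≡zeros⇒reach-constant f δf≡0 (connected M x (vertexDart M u)) ⟨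
      lookup f (vtx M x)            ≡⟨ Vecₚ.lookup-replicate u _ ⟨
      lookup (replicate (nv M) (lookup f (vtx M x))) u ∎

    replicate-cases : ∀ {f} b → f ≡ replicate (nv M) b → f ≡ zeros (nv M) ⊎ f ≡ ones
    replicate-cases false = inj₁
    replicate-cases true  = inj₂

    ker⇒const : ∀ f → δ M f ≡ zeros (ne M) → f ≡ zeros (nv M) ⊎ f ≡ ones
    ker⇒const f δf≡0 = replicate-cases _ (f≡replicate f δf≡0)

    const⇒ker : ∀ f → f ≡ zeros (nv M) ⊎ f ≡ ones → δ M f ≡ zeros (ne M)
    const⇒ker f (inj₁ refl) = δ-replicate false
    const⇒ker f (inj₂ refl) = δ-replicate true

  ∣im-∂∣ : Dart M → 2 * count (Im? (∂ M)) ≡ 2 ^ nf M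
  ∣im-∂∣ x = trans (cong (2 *_) (count-cong (Im? (∂ M)) Even? (λ { w (g , refl) → ∂-parity M g }) (even⇒boundary x)))
                  (count-even (face M x))

rank-balance : ∀ {a b c} I C K → 2 * I ≡ 2 ^ a → 2 * C ≡ 2 ^ b → K * C ≡ 2 ^ c → a + b ≡ c + 2 → I ≡ K
rank-balance {b = b} I zero K _ 0≡2^b _ _ = ⊥-elim (ℕₚ.<-irrefl 0≡2^b (ℕₚ.m^n>0 2 b))
rank-balance {a} {b} {c} I C@(suc _) K 2I≡2^a 2C≡2^b KC≡2^c a+b≡c+2 = ℕₚ.*-cancelʳ-≡ I K (4 * C) (begin
  I * (4 * C)          ≡⟨ solve 2 (λ i c → i :* (con 4 :* c) := (con 2 :* i) :* (con 2 :* c)) refl I C ⟩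
  (2 * I) * (2 * C)    ≡⟨ cong₂ _*_ 2I≡2^a 2C≡2^b ⟩
  2 ^ a * 2 ^ b        ≡⟨ ℕₚ.^-distribˡ-+-* 2 a b ⟨
  2 ^ (a + b)          ≡⟨ cong (2 ^_) a+b≡c+2 ⟩
  2 ^ (c + 2)          ≡⟨ ℕₚ.^-distribˡ-+-* 2 c 2 ⟩
  2 ^ c * 4            ≡⟨ cong (_* 4) KC≡2^c ⟨
  K * C * 4            ≡⟨ solve 2 (λ k c → k :* c :* con 4 := k :* (con 4 :* c)) refl K C ⟩
  K * (4 * C)          ∎)
  where
  open ≡-Reasoning
  open +-*-Solver

module _ (M : PlaneGraph) where

  -- im δ ⊆ ker ∂, and by Euler's formula both have 2 ^ (nv - 1) = 2 ^ (ne - nf + 1) elements.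
  ker-∂⊆im-δ : Dart M → (∀ f → ∂ M (δ M f) ≡ zeros (nf M)) →
               ∀ g → ∂ M g ≡ zeros (nf M) → ∃ λ f → δ M f ≡ g
  ker-∂⊆im-δ x ∂δ≡0 = count-≡⇒⊇ (Im? (δ M)) (Ker? (∂ M)) im⊆ker
    (rank-balance {nv M} {nf M} {ne M} (count (Im? (δ M))) (count (Im? (∂ M))) (count (Ker? (∂ M)))
                  2∣im-δ∣ (∣im-∂∣ M x) (rank-nullity (∂ M) (∂-linear M)) (euler M))
    where
    im⊆ker : ∀ g → ∃ (λ f → δ M f ≡ g) → ∂ M g ≡ zeros (nf M)
    im⊆ker g (f , refl) = ∂δ≡0 f
    2∣im-δ∣ : 2 * count (Im? (δ M)) ≡ 2 ^ nv M
    2∣im-δ∣ = trans (cong (_* count (Im? (δ M))) (sym (∣ker-δ∣≡2 M x))) (rank-nullity (δ M) (δ-linear M))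

someDart : (M : PlaneGraph) → Dart M
someDart M with nv M in nv≡ | nf M in nf≡
... | suc _ | _     = vertexDart M (subst Fin (sym nv≡) zero)
... | zero  | suc _ = faceDart M (subst Fin (sym nf≡) zero)
... | zero  | zero  = ⊥-elim (0≢2+ (trans (cong₂ _+_ (sym nv≡) (sym nf≡)) (trans (euler M) (ℕₚ.+-comm (ne M) 2))))
  where
  0≢2+ : ∀ {m} → 0 ≢ suc (suc m)
  0≢2+ ()

triangleSum : (M : PlaneGraph) → (Fin (ne M) → Bool) → Dart M → Bool
triangleSum M g x = g (edge M x) xor (g (edge M (φ M x)) xor g (edge M (φ M (φ M x))))

Valid⇒IsTri : ∀ {M} k → Valid M k → ∀ {x} → Inner M k x → IsTri M x
Valid⇒IsTri mpg        valid {x} _     = valid x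
Valid⇒IsTri (semi n o) valid {x} inner = proj₂ (proj₂ valid) x inner

TriangleClosed : (M : PlaneGraph) → Kind M → (Fin (ne M) → Bool) → Set
TriangleClosed M k g = ∀ x → Inner M k x → triangleSum M g x ≡ false

Potential : (M : PlaneGraph) → (Fin (ne M) → Bool) → Set
Potential M g = ∃ λ (f : Fin (nv M) → Bool) → ∀ x → f (vtx M x) xor f (vtx M (α M x)) ≡ g (edge M x)

module _ (M : PlaneGraph) where

  ∂-closed-inner : ∀ k → Valid M k → ∀ g → TriangleClosed M k (lookup g) →
                   ∀ F → Inner M k (faceDart M F) → lookup (∂ M g) F ≡ false
  ∂-closed-inner k valid g closed F inner = begin
    lookup (∂ M g) F                          ≡⟨ cong (lookup (∂ M g)) (orbitRep-label (face-orb M) F) ⟨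
    lookup (∂ M g) (face M (faceDart M F))      ≡⟨ ∂-triangle M g (Valid⇒IsTri k valid inner) ⟩
    triangleSum M (lookup g) (faceDart M F)     ≡⟨ closed (faceDart M F) inner ⟩
    false                                     ∎
    where open ≡-Reasoning

  closed⇒∂≡zeros : ∀ k → Valid M k → ∀ g → TriangleClosed M k (lookup g) → ∂ M g ≡ zeros (nf M)
  closed⇒∂≡zeros k valid g closed = lookup-ext λ F → trans (every-face k valid closed F) (sym (Vecₚ.lookup-replicate F false))
    where
    every-face : ∀ k → Valid M k → TriangleClosed M k (lookup g) → ∀ F → lookup (∂ M g) F ≡ false
    every-face mpg        valid closed F = ∂-closed-inner mpg valid g closed F _
    -- The outer facet is not a triangle: its entry of ∂ g is forced by the parity of ∂ g.
    every-face (semi n o) valid closed F = outer-or-inner F (F ≟ face M o)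
      where
      off-outer : ∀ F → F ≢ face M o → lookup (∂ M g) F ≡ false
      off-outer F F≢outer = ∂-closed-inner (semi n o) valid g closed F
                              (F≢outer ∘ trans (sym (orbitRep-label (face-orb M) F)))
      outer-or-inner : ∀ F → Dec (F ≡ face M o) → lookup (∂ M g) F ≡ false
      outer-or-inner F (no F≢outer) = off-outer F F≢outer
      outer-or-inner F (yes refl)   = trans (sym (parity-concentrated (∂ M g) (face M o) off-outer)) (∂-parity M g)

  triangleSum-δ : ∀ f {x} → IsTri M x → triangleSum M (lookup (δ M f)) x ≡ false
  triangleSum-δ f {x} tri = begin
    triangleSum M (lookup (δ M f)) x
      ≡⟨ cong₂ _xor_ (δ-edge M f x) (cong₂ _xor_ (δ-edge M f (φ M x)) (δ-edge M f (φ M (φ M x)))) ⟩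
    dartDiff M f x xor (dartDiff M f (φ M x) xor dartDiff M f (φ M (φ M x)))
      ≡⟨ cong₂ (λ b c → (f₀ xor b) xor (c xor (f₂ xor lookup f (vtx M (α M (φ M (φ M x)))))))
               (cong (lookup f) (vtx-α≡vtx-φ M x)) (cong (f₁ xor_) (cong (lookup f) (vtx-α≡vtx-φ M (φ M x)))) ⟩
    (f₀ xor f₁) xor ((f₁ xor f₂) xor (f₂ xor lookup f (vtx M (α M (φ M (φ M x))))))
      ≡⟨ cong (λ c → (f₀ xor f₁) xor ((f₁ xor f₂) xor (f₂ xor c))) (cong (lookup f) (vtx-α-φ² M tri)) ⟩
    (f₀ xor f₁) xor ((f₁ xor f₂) xor (f₂ xor f₀))
      ≡⟨ xor-cycle f₀ f₁ f₂ ⟩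
    false ∎
    where
    open ≡-Reasoning
    f₀ f₁ f₂ : Bool
    f₀ = lookup f (vtx M x)
    f₁ = lookup f (vtx M (φ M x))
    f₂ = lookup f (vtx M (φ M (φ M x)))

  δ≡tabulate⇒potential : ∀ f g → δ M f ≡ tabulate g → Potential M g
  δ≡tabulate⇒potential f g δf≡g = lookup f , λ x → begin
    lookup f (vtx M x) xor lookup f (vtx M (α M x))  ≡⟨ δ-edge M f x ⟨
    lookup (δ M f) (edge M x)                        ≡⟨ cong (λ v → lookup v (edge M x)) δf≡g ⟩
    lookup (tabulate g) (edge M x)                   ≡⟨ Vecₚ.lookup∘tabulate g (edge M x) ⟩
    g (edge M x)                                     ∎
    where open ≡-Reasoning

  closed⇒potential : ∀ k → Valid M k → (g : Fin (ne M) → Bool) → TriangleClosed M k g → Potential M g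
  closed⇒potential k valid g closed =
    let (f , δf≡g) = ker-∂⊆im-δ M (someDart M) ∂δ≡zeros (tabulate g) (closed⇒∂≡zeros k valid (tabulate g) g-closed)
    in δ≡tabulate⇒potential f g δf≡g
    where
    ∂δ≡zeros : ∀ f → ∂ M (δ M f) ≡ zeros (nf M)
    ∂δ≡zeros f = closed⇒∂≡zeros k valid (δ M f) (λ x inner → triangleSum-δ f (Valid⇒IsTri k valid inner))
    g-closed : TriangleClosed M k (lookup (tabulate g))
    g-closed x inner = trans (cong₂ _xor_ (Vecₚ.lookup∘tabulate g _)
                                          (cong₂ _xor_ (Vecₚ.lookup∘tabulate g _) (Vecₚ.lookup∘tabulate g _)))
                             (closed x inner)

-- Red walks

odd : ℕ → Bool
odd zero    = false
odd (suc n) = not (odd n)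

odd-+ : ∀ m n → odd (m + n) ≡ odd m xor odd n
odd-+ zero    n = refl
odd-+ (suc m) n = trans (cong not (odd-+ m n)) (Boolₚ.not-distribˡ-xor (odd m) (odd n))

%2≡odd : ∀ n → n % 2 ≡ (if odd n then 1 else 0)
%2≡odd zero          = refl
%2≡odd (suc zero)    = refl
%2≡odd (suc (suc n)) = begin
  (2 + n) % 2                ≡⟨ cong (_% 2) (ℕₚ.+-comm 2 n) ⟩
  (n + 2) % 2                ≡⟨ [m+n]%n≡m%n n 2 ⟩
  n % 2                      ≡⟨ %2≡odd n ⟩
  (if odd n then 1 else 0)   ≡⟨ cong (if_then 1 else 0) (Boolₚ.not-involutive (odd n)) ⟨
  (if not (not (odd n)) then 1 else 0) ∎
  where open ≡-Reasoning

odd⇒%2≡1 : ∀ {n} → odd n ≡ true → n % 2 ≡ 1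
odd⇒%2≡1 {n} odd-n = trans (%2≡odd n) (cong (if_then 1 else 0) odd-n)

%2≡1⇒odd : ∀ {n} → n % 2 ≡ 1 → odd n ≡ true
%2≡1⇒odd {n} n%2≡1 with odd n | %2≡odd n
... | true  | _     = refl
... | false | n%2≡0 = case trans (sym n%2≡1) n%2≡0 of λ ()

odd-segments : ∀ {i j L} → i ≤ j → j ≤ L → odd L ≡ odd (j ∸ i) xor odd (i + (L ∸ j))
odd-segments {i} {j} {L} i≤j j≤L = begin
  odd L                                       ≡⟨ cong odd (trans (sym (ℕₚ.m+[n∸m]≡n j≤L)) (cong (_+ (L ∸ j)) (sym (ℕₚ.m+[n∸m]≡n i≤j)))) ⟩
  odd ((i + (j ∸ i)) + (L ∸ j))               ≡⟨ trans (odd-+ (i + (j ∸ i)) (L ∸ j)) (cong (_xor odd (L ∸ j)) (odd-+ i (j ∸ i))) ⟩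
  (odd i xor odd (j ∸ i)) xor odd (L ∸ j)     ≡⟨ cong (_xor odd (L ∸ j)) (Boolₚ.xor-comm (odd i) (odd (j ∸ i))) ⟩
  (odd (j ∸ i) xor odd i) xor odd (L ∸ j)     ≡⟨ Boolₚ.xor-assoc (odd (j ∸ i)) (odd i) (odd (L ∸ j)) ⟩
  odd (j ∸ i) xor (odd i xor odd (L ∸ j))     ≡⟨ cong (odd (j ∸ i) xor_) (odd-+ i (L ∸ j)) ⟨
  odd (j ∸ i) xor odd (i + (L ∸ j))           ∎
  where open ≡-Reasoning

repetition? : ∀ {k} (h : ℕ → Fin k) L →
              (∃₂ λ i j → i < j × j < L × h i ≡ h j) ⊎ (∀ {i j} → i < L → j < L → h i ≡ h j → i ≡ j)
repetition? h L with ℕₚ.anyUpTo? (λ j → ℕₚ.anyUpTo? (λ i → h i Finₚ.≟ h j) j) L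
... | yes (j , j<L , i , i<j , eq) = inj₁ (i , j , i<j , j<L , eq)
... | no no-repetition = inj₂ injective
  where
  injective : ∀ {i j} → i < L → j < L → h i ≡ h j → i ≡ j
  injective {i} {j} i<L j<L eq with ℕₚ.<-cmp i j
  ... | tri< i<j _ _ = ⊥-elim (no-repetition (j , j<L , i , i<j , eq))
  ... | tri≈ _ i≡j _ = i≡j
  ... | tri> _ _ j<i = ⊥-elim (no-repetition (i , i<L , j , j<i , sym eq))

Least : ∀ {n} → Pred (Fin n) 0ℓ → Fin n → Set
Least P i = P i × (∀ {j} → P j → i Fin.≤ j)

least : ∀ {n} {P : Pred (Fin n) 0ℓ} → Decidable P → ∃ P → ∃ (Least P)
least {suc n} P? (v , Pv) with P? zero
... | yes P0 = zero , P0 , λ _ → z≤n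
least {suc n} P? (zero , Pv)  | no ¬P0 = ⊥-elim (¬P0 Pv)
least {suc n} P? (suc v , Pv) | no ¬P0 =
  let (i , Pi , minimal) = least (P? ∘ suc) (v , Pv) in
  suc i , Pi , λ { {zero} P0 → ⊥-elim (¬P0 P0) ; {suc j} Pj → s≤s (minimal Pj) }

Least-unique : ∀ {n} {P Q : Pred (Fin n) 0ℓ} {i j} → (∀ k → P k → Q k) → (∀ k → Q k → P k) →
               Least P i → Least Q j → i ≡ j
Least-unique P⇒Q Q⇒P (Pi , i-least) (Qj , j-least) = Finₚ.≤-antisym (i-least (Q⇒P _ Qj)) (j-least (P⇒Q _ Pi))

module RedWalk (M : PlaneGraph) (red : Fin (ne M) → Bool) where

  Vertex : Set
  Vertex = Fin (nv M)

  data Walk : Vertex → Vertex → ℕ → Set where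
    []   : ∀ {a} → Walk a a 0
    step : ∀ {a b L} (x : Dart M) → vtx M x ≡ a → red (edge M x) ≡ true →
           Walk (vtx M (α M x)) b L → Walk a b (suc L)

  private
    variable
      a b c : Vertex
      L K : ℕ

  infixr 5 _++ᵂ_

  _++ᵂ_ : Walk a b L → Walk b c K → Walk a c (L + K)
  []            ++ᵂ w′ = w′
  step x tx r w ++ᵂ w′ = step x tx r (w ++ᵂ w′)

  edgeWalk : (x : Dart M) → red (edge M x) ≡ true → Walk (vtx M x) (vtx M (α M x)) 1
  edgeWalk x r = step x refl r []

  private
    reverse-onto : Walk a b L → Walk a c K → Walk b c (L + K)
    reverse-onto                     []                acc = acc
    reverse-onto {L = suc L} {K = K} (step x refl r w) acc =
      subst (Walk _ _) (ℕₚ.+-suc L K)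
        (reverse-onto w (step (α M x) refl (trans (cong red (edge-α M x)) r)
                              (subst (λ y → Walk (vtx M y) _ K) (sym (α-invol M x)) acc)))

  reverse : Walk a b L → Walk b a L
  reverse {L = L} w = subst (Walk _ _) (ℕₚ.+-identityʳ L) (reverse-onto w [])

  vertexAt : Walk a b L → ℕ → Vertex
  vertexAt {a} w               zero    = a
  vertexAt {a} []              (suc i) = a
  vertexAt     (step x _ _ w)  (suc i) = vertexAt w i

  vertexAt-last : (w : Walk a b L) → vertexAt w L ≡ b
  vertexAt-last []             = refl
  vertexAt-last (step x _ _ w) = vertexAt-last w

  dartAt : Dart M → Walk a b L → ℕ → Dart M
  dartAt d []             i       = d
  dartAt d (step x _ _ w) zero    = x
  dartAt d (step x _ _ w) (suc i) = dartAt d w i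

  dartAt-tail : ∀ d (w : Walk a b L) {i} → i < L → vtx M (dartAt d w i) ≡ vertexAt w i
  dartAt-tail d (step x tx _ w) {zero}  _         = tx
  dartAt-tail d (step x _  _ w) {suc i} (s≤s i<L) = dartAt-tail d w i<L

  dartAt-head : ∀ d (w : Walk a b L) {i} → i < L → vtx M (α M (dartAt d w i)) ≡ vertexAt w (suc i)
  dartAt-head d (step x _ _ w) {zero}  _         = refl
  dartAt-head d (step x _ _ w) {suc i} (s≤s i<L) = dartAt-head d w i<L

  dartAt-red : ∀ d (w : Walk a b L) {i} → i < L → red (edge M (dartAt d w i)) ≡ true
  dartAt-red d (step x _ r w) {zero}  _         = r
  dartAt-red d (step x _ _ w) {suc i} (s≤s i<L) = dartAt-red d w i<L

  splitAt : (w : Walk a b L) (j : ℕ) → j ≤ L → Walk a (vertexAt w j) j × Walk (vertexAt w j) b (L ∸ j)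
  splitAt w                 zero    _         = [] , w
  splitAt (step x refl r w) (suc j) (s≤s j≤L) = let (w₁ , w₂) = splitAt w j j≤L in step x refl r w₁ , w₂

  cut : (w : Walk a b L) {i j : ℕ} → i < j → j ≤ L → vertexAt w i ≡ vertexAt w j →
        ∃ λ c → Walk a c i × Walk c c (j ∸ i) × Walk c b (L ∸ j)
  cut {a} {b} {L} w {zero} {j} _ j≤L eq =
    let (w₁ , w₂) = splitAt w j j≤L in
    a , [] , subst (λ c → Walk a c j) (sym eq) w₁ , subst (λ c → Walk c b (L ∸ j)) (sym eq) w₂
  cut (step x refl r w) {suc i} {suc j} (s≤s i<j) (s≤s j≤L) eq =
    let (c , w₁ , loop , w₂) = cut w i<j j≤L eq in c , step x refl r w₁ , loop , w₂

  walk? : ∀ a b L → Dec (Walk a b L)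
  walk? a b zero with a Finₚ.≟ b
  ... | yes refl = yes []
  ... | no  a≢b  = no λ { [] → a≢b refl }
  walk? a b (suc L)
    with Finₚ.any? (λ x → (vtx M x Finₚ.≟ a) ×-dec (red (edge M x) Boolₚ.≟ true) ×-dec walk? (vtx M (α M x)) b L)
  ... | yes (x , tx , r , w) = yes (step x tx r w)
  ... | no  no-step          = no λ { (step x tx r w) → no-step (x , tx , r , w) }

  closed-odd-walk-length : Walk c c L → odd L ≡ true → 3 ≤ L
  closed-odd-walk-length {L = 1}                 (step x tx _ []) _ = ⊥-elim (no-loop M x tx)
  closed-odd-walk-length {L = suc (suc (suc L))} _                _ = s≤s (s≤s (s≤s z≤n))

  distinct-closed-walk⇒cycle : (w : Walk c c L) → odd L ≡ true →
                                (∀ {i j} → i < L → j < L → vertexAt w i ≡ vertexAt w j → i ≡ j) →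
                                RedOddCycle M red
  distinct-closed-walk⇒cycle {c} {suc L} w@(step x _ _ _) odd-L distinct =
    suc L , dartAt x w , closed-odd-walk-length w odd-L , odd⇒%2≡1 {suc L} odd-L ,
    (λ i i+1<L → trans (dartAt-head x w (ℕₚ.<-trans (ℕₚ.n<1+n i) i+1<L)) (sym (dartAt-tail x w i+1<L))) ,
    (λ { i refl → trans (dartAt-head x w (ℕₚ.n<1+n i)) (trans (vertexAt-last w) (sym (dartAt-tail x w (s≤s z≤n)))) }) ,
    (λ i j i<L j<L eq → distinct i<L j<L (trans (sym (dartAt-tail x w i<L)) (trans eq (dartAt-tail x w j<L)))) ,
    (λ i i<L → dartAt-red x w i<L)

  -- A repeated vertex cuts the walk into a loop and the rest: both are shorter, one of them is odd.
  odd-closed-walk⇒cycle : Walk c c L → odd L ≡ true → RedOddCycle M red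
  odd-closed-walk⇒cycle {c} {L} = <-rec OddClosedWalk⇒Cycle shrink L
    where
    OddClosedWalk⇒Cycle : ℕ → Set
    OddClosedWalk⇒Cycle L = ∀ {c} → Walk c c L → odd L ≡ true → RedOddCycle M red

    shrink : ∀ L → (∀ {K} → K < L → OddClosedWalk⇒Cycle K) → OddClosedWalk⇒Cycle L
    shrink L shorter w odd-L with repetition? (vertexAt w) L
    ... | inj₂ distinct = distinct-closed-walk⇒cycle w odd-L distinct
    ... | inj₁ (i , j , i<j , j<L , eq) with cut w i<j (ℕₚ.<⇒≤ j<L) eq | odd (j ∸ i) in odd-loop
    ...   | (v , w₁ , loop , w₂) | true  =
      shorter (ℕₚ.≤-<-trans (ℕₚ.m∸n≤m j i) j<L) loop odd-loop
    ...   | (v , w₁ , loop , w₂) | false =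
      shorter rest<L (subst (Walk v v) (ℕₚ.+-comm (L ∸ j) i) (w₂ ++ᵂ w₁))
              (trans (sym (cong (_xor odd (i + (L ∸ j))) odd-loop))
                     (trans (sym (odd-segments (ℕₚ.<⇒≤ i<j) (ℕₚ.<⇒≤ j<L))) odd-L))
      where
      rest<L : i + (L ∸ j) < L
      rest<L = subst (i + (L ∸ j) <_) (ℕₚ.m+[n∸m]≡n (ℕₚ.<⇒≤ j<L)) (ℕₚ.+-monoˡ-< (L ∸ j) i<j)

module _ (M : PlaneGraph) (red : Fin (ne M) → Bool) (no-cycle : ¬ RedOddCycle M red) where
  open RedWalk M red

  private
    variable
      a b c : Vertex
      L : ℕ

  closed-walk-even : Walk c c L → odd L ≡ false
  closed-walk-even {L = L} w with odd L in odd-L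
  ... | false = refl
  ... | true  = ⊥-elim (no-cycle (odd-closed-walk⇒cycle w odd-L))

  ShortWalk : Vertex → Vertex → (ℕ → Set) → Set
  ShortWalk a b P = ∃ λ L → L ≤ nv M × P L × Walk a b L

  shorten : Walk a b L → ShortWalk a b (λ L′ → odd L′ ≡ odd L)
  shorten {a} {b} {L} = <-rec (λ L → Walk a b L → ShortWalk a b (λ L′ → odd L′ ≡ odd L)) shrink L
    where
    shrink : ∀ L → (∀ {K} → K < L → Walk a b K → ShortWalk a b (λ L′ → odd L′ ≡ odd K)) →
             Walk a b L → ShortWalk a b (λ L′ → odd L′ ≡ odd L)
    shrink L shorter w with L ℕₚ.≤? nv M
    ... | yes L≤nv = L , L≤nv , refl , w
    ... | no  L≰nv with Finₚ.pigeonhole (ℕₚ.m<n⇒m<1+n (ℕₚ.≰⇒> L≰nv)) (vertexAt w ∘ toℕ)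
    ...   | fi , fj , fi<fj , eq with cut w fi<fj (s≤s⁻¹ (Finₚ.toℕ<n fj)) eq
    ...     | (v , w₁ , loop , w₂) =
      let (L′ , L′≤nv , same-parity , w′) = shorter rest<L (w₁ ++ᵂ w₂) in
      L′ , L′≤nv , trans same-parity rest-parity , w′
      where
      i j : ℕ
      i = toℕ fi
      j = toℕ fj
      j≤L : j ≤ L
      j≤L = s≤s⁻¹ (Finₚ.toℕ<n fj)
      rest<L : i + (L ∸ j) < L
      rest<L = subst (i + (L ∸ j) <_) (ℕₚ.m+[n∸m]≡n j≤L) (ℕₚ.+-monoˡ-< (L ∸ j) fi<fj)
      rest-parity : odd (i + (L ∸ j)) ≡ odd L
      rest-parity = sym (trans (odd-segments (ℕₚ.<⇒≤ fi<fj) j≤L) (cong (_xor odd (i + (L ∸ j))) (closed-walk-even loop)))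

  -- Walks of length at most nv suffice (shorten), which makes red-linkedness decidable.
  shortWalk? : ∀ a b {P : ℕ → Set} → (∀ L → Dec (P L)) → Dec (ShortWalk a b P)
  shortWalk? a b P? =
    map′ (λ (L , L<1+nv , PL , w) → L , s≤s⁻¹ L<1+nv , PL , w) (λ (L , L≤nv , PL , w) → L , s≤s L≤nv , PL , w)
         (ℕₚ.anyUpTo? (λ L → P? L ×-dec walk? a b L) (suc (nv M)))

  Linked EvenLinked : Vertex → Vertex → Set
  Linked     a b = ShortWalk a b (λ _ → ⊤)
  EvenLinked a b = ShortWalk a b (λ L → odd L ≡ false)

  evenLinked? : ∀ a b → Dec (EvenLinked a b)
  evenLinked? a b = shortWalk? a b (λ L → odd L Boolₚ.≟ false)

  root : Vertex → Vertex
  root v = proj₁ (least (λ u → shortWalk? u v (λ _ → yes tt)) (v , 0 , z≤n , tt , []))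

  root-least : ∀ v → Least (λ u → Linked u v) (root v)
  root-least v = proj₂ (least (λ u → shortWalk? u v (λ _ → yes tt)) (v , 0 , z≤n , tt , []))

  side : Vertex → Bool
  side v = does (evenLinked? (root v) v)

  module _ (x : Dart M) (x-red : red (edge M x) ≡ true) where
    private
      u v : Vertex
      u = vtx M x
      v = vtx M (α M x)

      linked-extend : ∀ {u v} → Walk u v 1 → ∀ w → Linked w u → Linked w v
      linked-extend e w (L , _ , _ , walk) = let (L′ , L′≤nv , _ , walk′) = shorten (walk ++ᵂ e) in L′ , L′≤nv , tt , walk′

      same-root : root u ≡ root v
      same-root = Least-unique (linked-extend (edgeWalk x x-red)) (linked-extend (reverse (edgeWalk x x-red)))
                               (root-least u) (root-least v)

      parities-differ : ∀ {r} → Linked r u → (d₁ : Dec (EvenLinked r u)) (d₂ : Dec (EvenLinked r v)) → does d₁ ≢ does d₂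
      parities-differ _ (yes (L₁ , _ , even₁ , w₁)) (yes (L₂ , _ , even₂ , w₂)) _ =
        true≢false (trans (sym odd-closed) (closed-walk-even (w₁ ++ᵂ edgeWalk x x-red ++ᵂ reverse w₂)))
        where
        true≢false : true ≢ false
        true≢false ()
        odd-closed : odd (L₁ + (1 + L₂)) ≡ true
        odd-closed = trans (odd-+ L₁ (suc L₂)) (cong₂ (λ a b → a xor not b) even₁ even₂)
      parities-differ (L , L≤nv , _ , w) (no ¬even₁) (no ¬even₂) _ with odd L in odd-L
      ... | false = ¬even₁ (L , L≤nv , odd-L , w)
      ... | true  = let (L′ , L′≤nv , same-parity , w′) = shorten (w ++ᵂ edgeWalk x x-red) in
                    ¬even₂ (L′ , L′≤nv , trans same-parity (trans (odd-+ L 1) (cong (_xor true) odd-L)) , w′)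
      parities-differ _ (yes _) (no _) ()
      parities-differ _ (no _) (yes _) ()

    side-flips : side u ≢ side v
    side-flips eq = parities-differ (proj₁ (root-least u)) (evenLinked? (root u) u) (evenLinked? (root u) v)
                                    (trans eq (cong (λ r → does (evenLinked? r v)) (sym same-root)))

red-bipartition : ∀ M (red : Fin (ne M) → Bool) → ¬ RedOddCycle M red →
                  ∃ λ (side : Fin (nv M) → Bool) → ∀ x → red (edge M x) ≡ true → side (vtx M x) ≢ side (vtx M (α M x))
red-bipartition M red no-cycle = side M red no-cycle , side-flips M red no-cycle

flipping⇒no-odd-cycle : ∀ M (red : Fin (ne M) → Bool) (f : Fin (nv M) → Bool) →
                        (∀ x → red (edge M x) ≡ true → f (vtx M x) xor f (vtx M (α M x)) ≡ true) →
                        ¬ RedOddCycle M red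
flipping⇒no-odd-cycle M red f flips (suc len , w , _ , len%2 , consecutive , wrap , _ , all-red) =
  not-fixed (f (vtx M (w 0))) (begin
    not (f (vtx M (w 0)))                  ≡⟨ cong not (Boolₚ.xor-identityʳ (f (vtx M (w 0)))) ⟨
    not (f (vtx M (w 0)) xor false)        ≡⟨ cong (λ b → not (f (vtx M (w 0)) xor b)) len-even ⟨
    not (f (vtx M (w 0)) xor odd len)      ≡⟨ cong not (alternates len (ℕₚ.n<1+n len)) ⟨
    not (f (vtx M (w len)))                ≡⟨ flip len (ℕₚ.n<1+n len) ⟨
    f (vtx M (α M (w len)))                ≡⟨ cong f (wrap len refl) ⟩
    f (vtx M (w 0))                        ∎)
  where
  open ≡-Reasoning
  flip : ∀ i → i < suc len → f (vtx M (α M (w i))) ≡ not (f (vtx M (w i)))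
  flip i i<len = xor≡true⇒≡not (flips (w i) (all-red i i<len))
  alternates : ∀ i → i < suc len → f (vtx M (w i)) ≡ f (vtx M (w 0)) xor odd i
  alternates zero    _       = sym (Boolₚ.xor-identityʳ _)
  alternates (suc i) i+1<len = begin
    f (vtx M (w (suc i)))             ≡⟨ cong f (consecutive i i+1<len) ⟨
    f (vtx M (α M (w i)))             ≡⟨ flip i (ℕₚ.<-trans (ℕₚ.n<1+n i) i+1<len) ⟩
    not (f (vtx M (w i)))             ≡⟨ cong not (alternates i (ℕₚ.<-trans (ℕₚ.n<1+n i) i+1<len)) ⟩
    not (f (vtx M (w 0)) xor odd i)   ≡⟨ Boolₚ.not-distribʳ-xor (f (vtx M (w 0))) (odd i) ⟩
    f (vtx M (w 0)) xor odd (suc i)   ∎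
  len-even : odd len ≡ false
  len-even = trans (sym (Boolₚ.not-involutive (odd len))) (cong not (%2≡1⇒odd {suc len} len%2))
  not-fixed : ∀ b → not b ≢ b
  not-fixed false ()
  not-fixed true  ()

-- Colourings and tilings

bits : Fin 4 → Bool × Bool
bits zero                   = false , false
bits (suc zero)             = false , true
bits (suc (suc zero))       = true  , false
bits (suc (suc (suc zero))) = true  , true

fromBits : Bool → Bool → Fin 4
fromBits false false = zero
fromBits false true  = suc zero
fromBits true  false = suc (suc zero)
fromBits true  true  = suc (suc (suc zero))

bits-fromBits : ∀ a b → bits (fromBits a b) ≡ (a , b)
bits-fromBits false false = refl
bits-fromBits false true  = refl
bits-fromBits true  false = refl
bits-fromBits true  true  = refl

fromBits-injective : ∀ {a b a′ b′} → fromBits a b ≡ fromBits a′ b′ → a ≡ a′ × b ≡ b′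
fromBits-injective {a} {b} {a′} {b′} eq =
  ,-injective (trans (sym (bits-fromBits a b)) (trans (cong bits eq) (bits-fromBits a′ b′)))

fromBits-≡⇒xor≡false : ∀ {a b a′ b′} → fromBits a b ≡ fromBits a′ b′ → a xor a′ ≡ false × b xor b′ ≡ false
fromBits-≡⇒xor≡false {a′ = a′} {b′ = b′} eq with fromBits-injective eq
... | refl , refl = Boolₚ.xor-same a′ , Boolₚ.xor-same b′

edgeBits : Fin 3 → Bool × Bool
edgeBits zero             = true  , false
edgeBits (suc zero)       = false , true
edgeBits (suc (suc zero)) = true  , true

fromEdgeBits : Bool → Bool → Fin 3
fromEdgeBits true  false = zero
fromEdgeBits false true  = suc zero
fromEdgeBits true  true  = suc (suc zero)
fromEdgeBits false false = zero   -- junk: only the difference of equal colours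

isRed : Fin 3 → Bool
isRed c = c ≡ᵇ zero

difference : Fin 4 → Fin 4 → Fin 3
difference a b = fromEdgeBits (proj₁ (bits a) xor proj₁ (bits b)) (proj₂ (bits a) xor proj₂ (bits b))

difference-comm : ∀ a b → difference a b ≡ difference b a
difference-comm a b = cong₂ fromEdgeBits (Boolₚ.xor-comm (proj₁ (bits a)) _) (Boolₚ.xor-comm (proj₂ (bits a)) _)

difference-distinct : ∀ a b c → a ≢ b × b ≢ c × c ≢ a → difference a b ≢ difference b c
difference-distinct = from-yes (all? λ a → all? λ b → all? λ c →
  (¬? (a ≟ b) ×-dec ¬? (b ≟ c) ×-dec ¬? (c ≟ a)) →-dec ¬? (difference a b ≟ difference b c))

RGBTriangleFacts : Fin 3 → Fin 3 → Fin 3 → Set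
RGBTriangleFacts a b c =
  (proj₁ (edgeBits a) xor (proj₁ (edgeBits b) xor proj₁ (edgeBits c)) ≡ false)
  × (proj₂ (edgeBits a) xor (proj₂ (edgeBits b) xor proj₂ (edgeBits c)) ≡ false)
  × (redCount (isRed a) + redCount (isRed b) + redCount (isRed c) ≡ 1)

rgb-triangle : ∀ a b c → a ≢ b × b ≢ c × a ≢ c → RGBTriangleFacts a b c
rgb-triangle = from-yes (all? λ a → all? λ b → all? λ c →
  (¬? (a ≟ b) ×-dec ¬? (b ≟ c) ×-dec ¬? (a ≟ c)) →-dec
  ((proj₁ (edgeBits a) xor (proj₁ (edgeBits b) xor proj₁ (edgeBits c)) Boolₚ.≟ false)
   ×-dec (proj₂ (edgeBits a) xor (proj₂ (edgeBits b) xor proj₂ (edgeBits c)) Boolₚ.≟ false)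
   ×-dec (redCount (isRed a) + redCount (isRed b) + redCount (isRed c) ℕₚ.≟ 1)))

edgeBits-nonzero : ∀ c → edgeBits c ≢ (false , false)
edgeBits-nonzero zero             ()
edgeBits-nonzero (suc zero)       ()
edgeBits-nonzero (suc (suc zero)) ()

red⇒first-bit : ∀ c → isRed c ≡ true → proj₁ (edgeBits c) ≡ true
red⇒first-bit zero _ = refl

one-red⇒black-closed : ∀ a b c → redCount a + redCount b + redCount c ≡ 1 → not a xor (not b xor not c) ≡ false
one-red⇒black-closed true  false false _ = refl
one-red⇒black-closed false true  false _ = refl
one-red⇒black-closed false false true  _ = refl
one-red⇒black-closed false false false ()
one-red⇒black-closed true  true  _     ()
one-red⇒black-closed true  false true  ()
one-red⇒black-closed false true  true  ()

module _ (M : PlaneGraph) where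

  differenceColouring : (Fin (nv M) → Fin 4) → Fin (ne M) → Fin 3
  differenceColouring c = onEdges M (λ y → difference (c (vtx M y)) (c (vtx M (α M y))))

  differenceColouring-edge : ∀ c x → differenceColouring c (edge M x) ≡ difference (c (vtx M x)) (c (vtx M (φ M x)))
  differenceColouring-edge c x =
    trans (onEdges-edge M (λ y → difference (c (vtx M y)) (c (vtx M (α M y)))) dart-α x)
          (cong (difference (c (vtx M x)) ∘ c) (vtx-α≡vtx-φ M x))
    where
    dart-α : ∀ y → difference (c (vtx M (α M y))) (c (vtx M (α M (α M y)))) ≡ difference (c (vtx M y)) (c (vtx M (α M y)))
    dart-α y = trans (cong (λ z → difference (c (vtx M (α M y))) (c (vtx M z))) (α-invol M y))
                     (difference-comm (c (vtx M (α M y))) (c (vtx M y)))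

module _ (M : PlaneGraph) (k : Kind M) (valid : Valid M k) where

  colouring⇒rgb-tiling : FourColorable M → HasRGBTiling M k
  colouring⇒rgb-tiling (c , proper) = differenceColouring M c , rgb
    where
    proper-φ : ∀ y → c (vtx M y) ≢ c (vtx M (φ M y))
    proper-φ y eq = proper y (trans eq (cong c (sym (vtx-α≡vtx-φ M y))))

    rgb : IsRGBTiling M k (differenceColouring M c)
    rgb x inner =
      (λ eq → difference-distinct A B C (A≢B , B≢C , C≢A) (trans (sym e₁) (trans eq e₂))) ,
      (λ eq → difference-distinct B C A (B≢C , C≢A , A≢B) (trans (sym e₂) (trans eq e₃))) ,
      (λ eq → difference-distinct C A B (C≢A , A≢B , B≢C) (trans (sym e₃) (trans (sym eq) e₁)))
      where
      A B C : Fin 4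
      A = c (vtx M x)
      B = c (vtx M (φ M x))
      C = c (vtx M (φ M (φ M x)))
      x≡φ³x : x ≡ φ M (φ M (φ M x))
      x≡φ³x = sym (proj₁ (Valid⇒IsTri k valid inner))
      A≢B : A ≢ B
      A≢B = proper-φ x
      B≢C : B ≢ C
      B≢C = proper-φ (φ M x)
      C≢A : C ≢ A
      C≢A eq = proper-φ (φ M (φ M x)) (trans eq (cong (c ∘ vtx M) x≡φ³x))
      e₁ : differenceColouring M c (edge M x) ≡ difference A B
      e₁ = differenceColouring-edge M c x
      e₂ : differenceColouring M c (edge M (φ M x)) ≡ difference B C
      e₂ = differenceColouring-edge M c (φ M x)
      e₃ : differenceColouring M c (edge M (φ M (φ M x))) ≡ difference C A
      e₃ = trans (differenceColouring-edge M c (φ M (φ M x))) (cong (difference C ∘ c ∘ vtx M) (sym x≡φ³x))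

  module _ (colour : Fin (ne M) → Fin 3) (rgb : IsRGBTiling M k colour) where
    private
      triangle : ∀ x → Inner M k x →
                 RGBTriangleFacts (colour (edge M x)) (colour (edge M (φ M x))) (colour (edge M (φ M (φ M x))))
      triangle x inner = rgb-triangle _ _ _ (rgb x inner)

    first-bit-potential : Potential M (proj₁ ∘ edgeBits ∘ colour)
    first-bit-potential = closed⇒potential M k valid (proj₁ ∘ edgeBits ∘ colour) (λ x inner → proj₁ (triangle x inner))

    second-bit-potential : Potential M (proj₂ ∘ edgeBits ∘ colour)
    second-bit-potential = closed⇒potential M k valid (proj₂ ∘ edgeBits ∘ colour) (λ x inner → proj₁ (proj₂ (triangle x inner)))

    red-tiling : IsRTiling M k (isRed ∘ colour)
    red-tiling x inner = proj₂ (proj₂ (triangle x inner))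

  rgb-tiling⇒colouring : HasRGBTiling M k → FourColorable M
  rgb-tiling⇒colouring (colour , rgb) = (λ v → fromBits (f₁ v) (f₂ v)) , proper
    where
    f₁ f₂ : Fin (nv M) → Bool
    f₁ = proj₁ (first-bit-potential colour rgb)
    f₂ = proj₁ (second-bit-potential colour rgb)

    proper : ∀ x → fromBits (f₁ (vtx M x)) (f₂ (vtx M x)) ≢ fromBits (f₁ (vtx M (α M x))) (f₂ (vtx M (α M x)))
    proper x eq = edgeBits-nonzero (colour (edge M x))
      (cong₂ _,_ (trans (sym (proj₂ (first-bit-potential colour rgb) x)) (proj₁ (fromBits-≡⇒xor≡false eq)))
                 (trans (sym (proj₂ (second-bit-potential colour rgb) x)) (proj₂ (fromBits-≡⇒xor≡false eq))))

  rgb-tiling⇒r-tiling : HasRGBTiling M k → HasRTilingNoRedOddCycle M k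
  rgb-tiling⇒r-tiling (colour , rgb) =
    isRed ∘ colour , red-tiling colour rgb ,
    flipping⇒no-odd-cycle M (isRed ∘ colour) (proj₁ (first-bit-potential colour rgb))
      (λ x x-red → trans (proj₂ (first-bit-potential colour rgb) x) (red⇒first-bit (colour (edge M x)) x-red))

  r-tiling⇒colouring : HasRTilingNoRedOddCycle M k → FourColorable M
  r-tiling⇒colouring (red , r-tiling , no-cycle) = (λ v → fromBits (p v) (q v)) , proper
    where
    red-sides : ∃ λ (p : Fin (nv M) → Bool) → ∀ x → red (edge M x) ≡ true → p (vtx M x) ≢ p (vtx M (α M x))
    red-sides = red-bipartition M red no-cycle

    black-potential : Potential M (not ∘ red)
    black-potential = closed⇒potential M k valid (not ∘ red)
      (λ x inner → one-red⇒black-closed (red (edge M x)) (red (edge M (φ M x))) (red (edge M (φ M (φ M x)))) (r-tiling x inner))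

    p q : Fin (nv M) → Bool
    p = proj₁ red-sides
    q = proj₁ black-potential

    proper : ∀ x → fromBits (p (vtx M x)) (q (vtx M x)) ≢ fromBits (p (vtx M (α M x))) (q (vtx M (α M x)))
    proper x eq = proj₂ red-sides x x-red (proj₁ (fromBits-injective eq))
      where
      x-not-black : not (red (edge M x)) ≡ false
      x-not-black = trans (sym (proj₂ black-potential x)) (proj₂ (fromBits-≡⇒xor≡false eq))
      x-red : red (edge M x) ≡ true
      x-red = trans (sym (Boolₚ.not-involutive (red (edge M x)))) (cong not x-not-black)

theorem6p7 : (M : PlaneGraph) (k : Kind M) → Valid M k →
    (FourColorable M ⇔ HasRGBTiling M k) × (HasRGBTiling M k ⇔ HasRTilingNoRedOddCycle M k)
theorem6p7 M k valid =
  mk⇔ (colouring⇒rgb-tiling M k valid) (rgb-tiling⇒colouring M k valid) ,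
  mk⇔ (rgb-tiling⇒r-tiling M k valid) (colouring⇒rgb-tiling M k valid ∘ r-tiling⇒colouring M k valid)
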